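{- Let $n$ and $m$ be positive integers with $n \ge 2$ and $m \le n-1$, and let $K_n - E(K_m)$ be the graph obtained from the complete graph $K_n$ by removing the edges (but not the vertices) of some complete subgraph $K_m$. Let $g = \tfrac{1}{2}\big[(n-1)(n-2) - m(m-1)\big]$. Then the $2$-fold interlacement $(K_n - E(K_m))[:]$ quadrangulates $\Sigma_g$, with vertex chromatic number equal to $n - m + 1$ and face chromatic number less than or equal to $n - m + 1$. Furthermore, if $g \ge 1$ and $n \ge 4 + 2m(m-1)$, any such quadrangulation is minimal on $\Sigma_g$.
   Context: All graphs are undirected, simple and finite; $\Sigma_g$ is the closed orientable surface with $g$ handles. The $2$-fold interlacement $G[:]$ of a graph $G$ has vertex set $\{v', v'' : v \in V(G)\}$; $v'$ and $v''$ are non-adjacent, and for each edge $vu$ of $G$ there are exactly the four edges $v'u', v'u'', v''u', v''u''$. A quadrangulation of $\Sigma_g$ with a graph $H$ is an embedding $H \to \Sigma_g$ in which every face is bounded by a simple cycle of length $4$ and every edge meets exactly two faces. The vertex chromatic number is that of the graph; the face chromatic number of a quadrangulation is the minimum number of colors in a coloring of its faces such that any two faces meeting a common edge get different colors. A quadrangulation of $\Sigma_g$ is minimal on $\Sigma_g$ if its number of vertices is minimum among all quadrangulations of $\Sigma_g$. -}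

module Defs where

open import Data.Nat using (ℕ; zero; suc; _+_; _*_; _∸_; _≤_; _<_; _<ᵇ_; _/_)
open import Data.Bool using (Bool; true; false; T; _∧_; not; if_then_else_)
open import Data.Fin using (Fin; toℕ; splitAt) renaming (zero to fz; suc to fs)
open import Data.Sum using (_⊎_; inj₁; inj₂; [_,_]′)
open import Data.Product using (Σ; ∃; _×_; _,_)
open import Relation.Binary.PropositionalEquality using (_≡_; _≢_; subst)
open import Relation.Nullary using (¬_)

record Graph (N : ℕ) : Set where
  field
    adj     : Fin N → Fin N → Bool
    adj-sym : ∀ u v → adj u v ≡ adj v u
    adj-irr : ∀ v → adj v v ≡ false
open Graph public

Σfin : (n : ℕ) → (Fin n → ℕ) → ℕ
Σfin zero    f = 0
Σfin (suc n) f = f fz + Σfin n (λ i → f (fs i))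

numEdges : ∀ {N} → Graph N → ℕ
numEdges {N} G =
  Σfin N (λ u → Σfin N (λ v → if (toℕ u <ᵇ toℕ v) ∧ adj G u v then 1 else 0))

data Reach {N} (G : Graph N) : Fin N → Fin N → Set where
  here : ∀ {v} → Reach G v v
  step : ∀ {u w v} → T (adj G u w) → Reach G w v → Reach G u v

Connected : ∀ {N} → Graph N → Set
Connected {N} G = ∀ (u v : Fin N) → Reach G u v

ProperColoring : ∀ {N} → Graph N → ℕ → Set
ProperColoring {N} G k =
  Σ (Fin N → Fin k) λ c → ∀ u v → T (adj G u v) → c u ≢ c v

IsChromaticNumber : ∀ {N} → Graph N → ℕ → Set
IsChromaticNumber G k = ProperColoring G k × (∀ j → j < k → ¬ ProperColoring G j)

record Dart {N} (G : Graph N) : Set where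
  constructor dart
  field
    tl : Fin N
    hd : Fin N
    ok : T (adj G tl hd)
open Dart public

rev : ∀ {N} {G : Graph N} → Dart G → Dart G
rev {G = G} (dart u v p) = dart v u (subst T (adj-sym G u v) p)

iter : {A : Set} → ℕ → (A → A) → A → A
iter zero    f x = x
iter (suc k) f x = f (iter k f x)

-- A quadrangulation of Σ_g with graph G, encoded combinatorially
-- (Heffter–Edmonds): a rotation system σ (cyclic order of darts around each
-- vertex) determines a cellular embedding in an orientable surface; its faces
-- are the orbits of φ = σ ∘ rev.
record Quadrangulation {N} (G : Graph N) (g : ℕ) : Set where
  field
    σ        : Dart G → Dart G
    σ⁻¹      : Dart G → Dart G
    σ-inv₁   : ∀ d → σ⁻¹ (σ d) ≡ d
    σ-inv₂   : ∀ d → σ (σ⁻¹ d) ≡ d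
    σ-tail   : ∀ d → tl (σ d) ≡ tl d
    σ-cyclic : ∀ d d' → tl d ≡ tl d' → ∃ λ k → iter k σ d ≡ d'
    faces      : ℕ
    face       : Dart G → Fin faces
    face-surj  : ∀ f → ∃ λ d → face d ≡ f
    face-orb₁  : ∀ d d' → face d ≡ face d' → ∃ λ k → iter k (λ e → σ (rev e)) d ≡ d'
    face-orb₂  : ∀ d → face (σ (rev d)) ≡ face d
    quad-len   : ∀ d → iter 4 (λ e → σ (rev e)) d ≡ d
    quad-simple : ∀ d → ∀ i j → i < 4 → j < 4 → i ≢ j →
                  tl (iter i (λ e → σ (rev e)) d) ≢ tl (iter j (λ e → σ (rev e)) d)
    two-faces  : ∀ d → face d ≢ face (rev d)
    -- the surface is connected and has genus g: V - E + F = 2 - 2g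
    connected  : Connected G
    euler      : N + faces + 2 * g ≡ 2 + numEdges G
open Quadrangulation public

FaceColoring : ∀ {N} {G : Graph N} {g} → Quadrangulation G g → ℕ → Set
FaceColoring Q k =
  Σ (Fin (faces Q) → Fin k) λ c → ∀ d → c (face Q d) ≢ c (face Q (rev d))

IsFaceChromaticNumber : ∀ {N} {G : Graph N} {g} → Quadrangulation G g → ℕ → Set
IsFaceChromaticNumber Q k = FaceColoring Q k × (∀ j → j < k → ¬ FaceColoring Q j)

IsMinimal : ∀ {N} {G : Graph N} {g} → Quadrangulation G g → Set
IsMinimal {N} {g = g} Q = ∀ N' (H : Graph N') → Quadrangulation H g → N ≤ N'

KnMinusKm : (n m : ℕ) → Graph n
adj (KnMinusKm n m) u v =
  not (toℕ u Data.Nat.≡ᵇ toℕ v) ∧ not ((toℕ u <ᵇ m) ∧ (toℕ v <ᵇ m))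
adj-sym (KnMinusKm n m) u v = sym-lemma (toℕ u) (toℕ v)
  where
  open import Relation.Binary.PropositionalEquality using (refl; cong₂)
  open import Data.Bool.Properties using (∧-comm)
  open import Data.Nat.Properties using ()
  eqb-sym : ∀ a b → (a Data.Nat.≡ᵇ b) ≡ (b Data.Nat.≡ᵇ a)
  eqb-sym zero zero = refl
  eqb-sym zero (suc b) = refl
  eqb-sym (suc a) zero = refl
  eqb-sym (suc a) (suc b) = eqb-sym a b
  sym-lemma : ∀ a b → (not (a Data.Nat.≡ᵇ b) ∧ not ((a <ᵇ m) ∧ (b <ᵇ m)))
                    ≡ (not (b Data.Nat.≡ᵇ a) ∧ not ((b <ᵇ m) ∧ (a <ᵇ m)))
  sym-lemma a b rewrite eqb-sym a b | ∧-comm (a <ᵇ m) (b <ᵇ m) = refl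
adj-irr (KnMinusKm n m) v = irr (toℕ v)
  where
  open import Relation.Binary.PropositionalEquality using (refl)
  eqb-refl : ∀ a → (a Data.Nat.≡ᵇ a) ≡ true
  eqb-refl zero = refl
  eqb-refl (suc a) = eqb-refl a
  irr : ∀ a → (not (a Data.Nat.≡ᵇ a) ∧ not ((a <ᵇ m) ∧ (a <ᵇ m))) ≡ false
  irr a rewrite eqb-refl a = refl

-- 2-fold interlacement G[:] on Fin (N + N): i < N is v', i ≥ N is v''

base : ∀ {N} → Fin (N + N) → Fin N
base {N} i = [ (λ v → v) , (λ v → v) ]′ (splitAt N i)

interlace : ∀ {N} → Graph N → Graph (N + N)
adj (interlace G) i j = adj G (base i) (base j)
adj-sym (interlace G) i j = adj-sym G (base i) (base j)
adj-irr (interlace G) i = adj-irr G (base i)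

genusFormula : ℕ → ℕ → ℕ
genusFormula n m = ((n ∸ 1) * (n ∸ 2) ∸ m * (m ∸ 1)) / 2

{-# OPTIONS --safe #-}
module Submission where

-- Give G = K_n − E(K_m) the rotation in which every vertex meets its neighbours in increasing cyclic
-- order, and let the rotation of G[:] run through u′v′, u′v″, u′w′, u′w″, … (w = ρ⁻¹ u v) at u′ and
-- the other way round at u″. Every face is then a 4-cycle u′ v′ u″ (ρ u v)″, one for each corner (u, v)
-- of G, so F = 2|E(G)| = E(G[:]) / 2 and Euler's formula gives g = |E(G)| − n + 1.
-- Colouring K_m by 0 and the other vertices by 1, …, n − m is proper on G[:], and the vertex 0 with the
-- n − m vertices outside K_m is a clique. The faces are 2-coloured by the side of their corner vertex when
-- G is a star (n = m + 1); otherwise a parity rule 3-colours them and three pairwise adjacent faces show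
-- that 3 colours are needed. Finally, in any quadrangulation 2E ≤ 4F, so Euler's formula gives
-- 4N + 8g ≤ 8 + N(N − 1), which for n ≥ 4 + 2m(m − 1) forces N ≥ 2n.

open import Defs
open import Data.Nat using (ℕ; _+_; _*_; _∸_; _≤_)
open import Data.Product using (Σ; ∃; _×_)
open import Data.Nat using (zero; suc; _<_; _<ᵇ_; _≡ᵇ_; z≤n; s≤s; s≤s⁻¹; _/_; _%_; NonZero; >-nonZero)
open import Data.Nat.Properties
open import Data.Nat.DivMod using (m*n/n≡m; m≡m%n+[m/n]*n; m%n<n)
open import Data.Nat.Solver using (module +-*-Solver)
open import Data.Bool using (Bool; true; false; T; _∧_; not; if_then_else_)
open import Data.Bool.Properties using (T-irrelevant; T-≡; T-∧; T-not-≡; ∧-zeroʳ; ∧-identityʳ)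
open import Data.Fin as F using (Fin; toℕ; fromℕ<; splitAt; _↑ˡ_; _↑ʳ_) renaming (zero to fz; suc to fs)
open import Data.Fin.Patterns using (0F; 1F; 2F)
import Data.Fin.Properties as FP
open import Data.Sum using (_⊎_; inj₁; inj₂; [_,_]′)
open import Data.Product using (_,_; proj₁; proj₂; uncurry)
open import Data.Empty using (⊥; ⊥-elim)
open import Data.Unit using (tt)
open import Function using (_∘_)
open import Function.Bundles using (Equivalence)
open import Relation.Binary.PropositionalEquality
open import Relation.Binary.Definitions using (tri<; tri≈; tri>)
open import Relation.Nullary using (¬_; yes; no)
open +-*-Solver using (solve; _:+_; _:*_; _:=_; con)

<ᵇ≡true⇒< : ∀ {a b} → (a <ᵇ b) ≡ true → a < b
<ᵇ≡true⇒< {a} {b} e = <ᵇ⇒< a b (subst T (sym e) tt)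

<ᵇ≡false⇒≥ : ∀ {a b} → (a <ᵇ b) ≡ false → b ≤ a
<ᵇ≡false⇒≥ e = ≮⇒≥ (λ a<b → subst T e (<⇒<ᵇ a<b))

<⇒<ᵇ≡true : ∀ {a b} → a < b → (a <ᵇ b) ≡ true
<⇒<ᵇ≡true = Equivalence.to T-≡ ∘ <⇒<ᵇ

≥⇒<ᵇ≡false : ∀ {a b} → b ≤ a → (a <ᵇ b) ≡ false
≥⇒<ᵇ≡false {a} {b} b≤a with a <ᵇ b in e
... | true  = ⊥-elim (<⇒≱ (<ᵇ≡true⇒< e) b≤a)
... | false = refl

≢⇒≡ᵇ≡false : ∀ {a b} → a ≢ b → (a ≡ᵇ b) ≡ false
≢⇒≡ᵇ≡false {a} {b} a≢b with a ≡ᵇ b in e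
... | true  = ⊥-elim (a≢b (≡ᵇ⇒≡ a b (subst T (sym e) tt)))
... | false = refl

iter-+ : ∀ {A : Set} a b (f : A → A) x → iter (a + b) f x ≡ iter a f (iter b f x)
iter-+ zero    b f x = refl
iter-+ (suc a) b f x = cong f (iter-+ a b f x)

iter-suc : ∀ {A : Set} a (f : A → A) x → iter (suc a) f x ≡ iter a f (f x)
iter-suc a f x = trans (cong (λ k → iter k f x) (+-comm 1 a)) (iter-+ a 1 f x)

iter-preserves : ∀ {A : Set} (P : A → Set) (f : A → A) → (∀ {x} → P x → P (f x)) →
                 ∀ k {x} → P x → P (iter k f x)
iter-preserves P f pf zero    px = px
iter-preserves P f pf (suc k) px = pf (iter-preserves P f pf k px)

iter-commute : ∀ {A B : Set} (h : A → B) (f : A → A) (g : B → B) → (∀ x → h (f x) ≡ g (h x)) →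
               ∀ k x → h (iter k f x) ≡ iter k g (h x)
iter-commute h f g hf≡gh zero    x = refl
iter-commute h f g hf≡gh (suc k) x = trans (hf≡gh (iter k f x)) (cong g (iter-commute h f g hf≡gh k x))

iter-periodic : ∀ {A : Set} p (f : A → A) x → iter p f x ≡ x → ∀ q → iter (q * p) f x ≡ x
iter-periodic p f x fᵖx≡x zero    = refl
iter-periodic p f x fᵖx≡x (suc q) =
  trans (iter-+ p (q * p) f x) (trans (cong (iter p f) (iter-periodic p f x fᵖx≡x q)) fᵖx≡x)

iter-mod : ∀ {A : Set} p .{{_ : NonZero p}} (f : A → A) x → iter p f x ≡ x →
           ∀ k → iter (k % p) f x ≡ iter k f x
iter-mod p f x fᵖx≡x k = begin
  iter (k % p) f x                         ≡⟨ cong (iter (k % p) f) (iter-periodic p f x fᵖx≡x (k / p)) ⟨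
  iter (k % p) f (iter ((k / p) * p) f x)  ≡⟨ iter-+ (k % p) ((k / p) * p) f x ⟨
  iter (k % p + (k / p) * p) f x           ≡⟨ cong (λ j → iter j f x) (m≡m%n+[m/n]*n k p) ⟨
  iter k f x                               ∎
  where open ≡-Reasoning

fromℕ<-≡ : ∀ {N k} (i : Fin N) .(k<N : k < N) → toℕ i ≡ k → fromℕ< k<N ≡ i
fromℕ<-≡ i k<N i≡k = trans (FP.fromℕ<-cong _ _ (sym i≡k) k<N (FP.toℕ<n i)) (FP.fromℕ<-toℕ i _)

cycSuc : ℕ → ℕ → ℕ
cycSuc d p = if suc p <ᵇ d then suc p else 0

cycPred : ℕ → ℕ → ℕ
cycPred d zero    = d ∸ 1
cycPred d (suc p) = p

cycSuc-< : ∀ {d p} → p < d → cycSuc d p < d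
cycSuc-< {d} {p} p<d with suc p <ᵇ d in e
... | true  = <ᵇ≡true⇒< e
... | false = ≤-<-trans z≤n p<d

cycPred-< : ∀ {d p} → p < d → cycPred d p < d
cycPred-< {suc d} {zero}  _   = n<1+n d
cycPred-< {d}     {suc p} p<d = <-trans (n<1+n p) p<d

cycSuc-step : ∀ {d p} → suc p < d → cycSuc d p ≡ suc p
cycSuc-step {d} {p} 1+p<d = cong (if_then suc p else 0) (<⇒<ᵇ≡true 1+p<d)

cycSuc-last : ∀ {d p} → d ≤ suc p → cycSuc d p ≡ 0
cycSuc-last {d} {p} d≤1+p = cong (if_then suc p else 0) (≥⇒<ᵇ≡false d≤1+p)

cycSuc-cycPred : ∀ {d p} → p < d → cycSuc d (cycPred d p) ≡ p
cycSuc-cycPred {suc d} {zero}  _   = cycSuc-last ≤-refl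
cycSuc-cycPred {d}     {suc p} p<d = cycSuc-step p<d

cycPred-cycSuc : ∀ {d p} → p < d → cycPred d (cycSuc d p) ≡ p
cycPred-cycSuc {suc d} {p} p<d with suc p <ᵇ suc d in e
... | true  = refl
... | false = ≤-antisym (s≤s⁻¹ (<ᵇ≡false⇒≥ e)) (s≤s⁻¹ p<d)

iter-cycSuc-+ : ∀ {d} p k → p + k < d → iter k (cycSuc d) p ≡ p + k
iter-cycSuc-+     p zero    _     = sym (+-identityʳ p)
iter-cycSuc-+ {d} p (suc k) p+1+k<d = begin
  cycSuc d (iter k (cycSuc d) p) ≡⟨ cong (cycSuc d) (iter-cycSuc-+ p k (<-trans (n<1+n (p + k)) 1+p+k<d)) ⟩
  cycSuc d (p + k)               ≡⟨ cycSuc-step 1+p+k<d ⟩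
  suc (p + k)                    ≡⟨ +-suc p k ⟨
  p + suc k                      ∎
  where
  open ≡-Reasoning
  1+p+k<d : suc (p + k) < d
  1+p+k<d = subst (_< d) (+-suc p k) p+1+k<d

cycSuc-transitive : ∀ {d p q} → p < d → q < d → ∃ λ t → iter t (cycSuc d) p ≡ q
cycSuc-transitive {d} {p} {q} p<d q<d with m≤n⇒∃[o]m+o≡n p<d
... | k , refl = q + suc k , (begin
    iter (q + suc k) (cycSuc d) p                  ≡⟨ iter-+ q (suc k) (cycSuc d) p ⟩
    iter q (cycSuc d) (iter (suc k) (cycSuc d) p)  ≡⟨ cong (iter q (cycSuc d) ∘ cycSuc d) (iter-cycSuc-+ p k ≤-refl) ⟩
    iter q (cycSuc d) (cycSuc d (p + k))           ≡⟨ cong (iter q (cycSuc d)) (cycSuc-last ≤-refl) ⟩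
    iter q (cycSuc d) 0                            ≡⟨ iter-cycSuc-+ 0 q q<d ⟩
    q                                              ∎)
  where open ≡-Reasoning

-- Finite sums

indicator : Bool → ℕ
indicator b = if b then 1 else 0

Σfin-cong : ∀ n {f g : Fin n → ℕ} → (∀ i → f i ≡ g i) → Σfin n f ≡ Σfin n g
Σfin-cong zero    f≡g = refl
Σfin-cong (suc n) f≡g = cong₂ _+_ (f≡g fz) (Σfin-cong n (f≡g ∘ fs))

Σfin-mono : ∀ n {f g : Fin n → ℕ} → (∀ i → f i ≤ g i) → Σfin n f ≤ Σfin n g
Σfin-mono zero    f≤g = z≤n
Σfin-mono (suc n) f≤g = +-mono-≤ (f≤g fz) (Σfin-mono n (f≤g ∘ fs))

Σfin-const : ∀ n c → Σfin n (λ _ → c) ≡ n * c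
Σfin-const zero    c = refl
Σfin-const (suc n) c = cong (c +_) (Σfin-const n c)

Σfin-+ : ∀ n (f g : Fin n → ℕ) → Σfin n (λ i → f i + g i) ≡ Σfin n f + Σfin n g
Σfin-+ zero    f g = refl
Σfin-+ (suc n) f g rewrite Σfin-+ n (f ∘ fs) (g ∘ fs) =
  solve 4 (λ a b c d → (a :+ b) :+ (c :+ d) := (a :+ c) :+ (b :+ d)) refl
    (f fz) (g fz) (Σfin n (f ∘ fs)) (Σfin n (g ∘ fs))

Σfin-swap : ∀ a b (f : Fin a → Fin b → ℕ) →
            Σfin a (λ i → Σfin b (f i)) ≡ Σfin b (λ j → Σfin a (λ i → f i j))
Σfin-swap zero    b f = sym (trans (Σfin-const b 0) (*-zeroʳ b))
Σfin-swap (suc a) b f = begin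
  Σfin b (f fz) + Σfin a (λ i → Σfin b (f (fs i)))      ≡⟨ cong (Σfin b (f fz) +_) (Σfin-swap a b (f ∘ fs)) ⟩
  Σfin b (f fz) + Σfin b (λ j → Σfin a (λ i → f (fs i) j)) ≡⟨ Σfin-+ b (f fz) _ ⟨
  Σfin b (λ j → Σfin (suc a) (λ i → f i j))               ∎
  where open ≡-Reasoning

Σfin-split : ∀ a b (f : Fin (a + b) → ℕ) →
             Σfin (a + b) f ≡ Σfin a (λ i → f (i ↑ˡ b)) + Σfin b (λ i → f (a ↑ʳ i))
Σfin-split zero    b f = refl
Σfin-split (suc a) b f rewrite Σfin-split a b (f ∘ fs) = sym (+-assoc (f fz) _ _)

Σfin-combine : ∀ a b (f : Fin (a * b) → ℕ) →
               Σfin a (λ i → Σfin b (λ j → f (F.combine i j))) ≡ Σfin (a * b) f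
Σfin-combine zero    b f = refl
Σfin-combine (suc a) b f =
  trans (cong (Σfin b (λ j → f (j ↑ˡ (a * b))) +_) (Σfin-combine a b (λ k → f (b ↑ʳ k))))
        (sym (Σfin-split b (a * b) f))

Σ< : ℕ → (ℕ → ℕ) → ℕ
Σ< zero    h = 0
Σ< (suc n) h = h 0 + Σ< n (h ∘ suc)

Σfin-toℕ : ∀ n (h : ℕ → ℕ) → Σfin n (h ∘ toℕ) ≡ Σ< n h
Σfin-toℕ zero    h = refl
Σfin-toℕ (suc n) h = cong (h 0 +_) (Σfin-toℕ n (h ∘ suc))

Σ<-cong : ∀ n {h k : ℕ → ℕ} → (∀ i → i < n → h i ≡ k i) → Σ< n h ≡ Σ< n k
Σ<-cong zero    h≡k = refl
Σ<-cong (suc n) h≡k = cong₂ _+_ (h≡k 0 (s≤s z≤n)) (Σ<-cong n (λ i i<n → h≡k (suc i) (s≤s i<n)))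

Σ<-const : ∀ n c → Σ< n (λ _ → c) ≡ n * c
Σ<-const zero    c = refl
Σ<-const (suc n) c = cong (c +_) (Σ<-const n c)

Σ<-split : ∀ a b (h : ℕ → ℕ) → Σ< (a + b) h ≡ Σ< a h + Σ< b (λ k → h (a + k))
Σ<-split zero    b h = refl
Σ<-split (suc a) b h rewrite Σ<-split a b (h ∘ suc) = sym (+-assoc (h 0) _ _)

count-≥ : ∀ n m → Σ< n (λ v → indicator (not (v <ᵇ m))) ≡ n ∸ m
count-≥ n       zero    = trans (Σ<-const n 1) (*-identityʳ n)
count-≥ zero    (suc m) = refl
count-≥ (suc n) (suc m) = count-≥ n m

count-≢ : ∀ n u → u < n → Σ< n (λ v → indicator (not (u ≡ᵇ v))) ≡ n ∸ 1
count-≢ (suc n) zero    _         = trans (Σ<-const n 1) (*-identityʳ n)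
count-≢ (suc n) (suc u) (s≤s u<n) = trans (cong suc (count-≢ n u u<n)) (suc-pred n ⦃ >-nonZero (≤-<-trans z≤n u<n) ⦄)

count-injection : ∀ N K (P : Fin N → Bool) (ι : ∀ i → T (P i) → Fin K) →
                  (∀ {i j p q} → ι i p ≡ ι j q → i ≡ j) → Σfin N (indicator ∘ P) ≤ K
count-injection zero    K P ι ι-inj = z≤n
count-injection (suc N) K P ι ι-inj with P fz in e
... | false = count-injection N K (P ∘ fs) (ι ∘ fs) (FP.suc-injective ∘ ι-inj)
... | true  = count-after-first K ι ι-inj (subst T (sym e) tt)
  where
  count-after-first : ∀ K (ι : ∀ i → T (P i) → Fin K) → (∀ {i j p q} → ι i p ≡ ι j q → i ≡ j) →
                      T (P fz) → suc (Σfin N (indicator ∘ P ∘ fs)) ≤ K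
  count-after-first zero    ι ι-inj p₀ = ⊥-elim (FP.¬Fin0 (ι fz p₀))
  count-after-first (suc K) ι ι-inj p₀ = s≤s (count-injection N K (P ∘ fs) ι′ ι′-inj)
    where
    ι₀≢ : ∀ i p → ι fz p₀ ≢ ι (fs i) p
    ι₀≢ i p eq with () ← ι-inj eq
    ι′ : ∀ i → T (P (fs i)) → Fin K
    ι′ i p = F.punchOut (ι₀≢ i p)
    ι′-inj : ∀ {i j p q} → ι′ i p ≡ ι′ j q → i ≡ j
    ι′-inj eq = FP.suc-injective (ι-inj (FP.punchOut-injective (ι₀≢ _ _) (ι₀≢ _ _) eq))

dartCount : ∀ {N} → Graph N → ℕ
dartCount {N} G = Σfin N (λ u → Σfin N (λ v → indicator (adj G u v)))

handshake : ∀ {N} (G : Graph N) → 2 * numEdges G ≡ dartCount G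
handshake {N} G = begin
  2 * numEdges G                                       ≡⟨ cong (numEdges G +_) (+-identityʳ _) ⟩
  numEdges G + numEdges G                              ≡⟨ cong (numEdges G +_) (Σfin-swap N N e) ⟩
  numEdges G + Σfin N (λ u → Σfin N (λ v → e v u))     ≡⟨ Σfin-+ N _ _ ⟨
  Σfin N (λ u → Σfin N (e u) + Σfin N (λ v → e v u))   ≡⟨ Σfin-cong N (λ u → Σfin-+ N (e u) (λ v → e v u)) ⟨
  Σfin N (λ u → Σfin N (λ v → e u v + e v u))          ≡⟨ Σfin-cong N (λ u → Σfin-cong N (λ v → split u v)) ⟨
  dartCount G                                          ∎
  where
  open ≡-Reasoning
  e : Fin N → Fin N → ℕ
  e u v = if (toℕ u <ᵇ toℕ v) ∧ adj G u v then 1 else 0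
  split : ∀ u v → indicator (adj G u v) ≡ e u v + e v u
  split u v with <-cmp (toℕ u) (toℕ v)
  ... | tri< u<v _ _ rewrite <⇒<ᵇ≡true u<v | ≥⇒<ᵇ≡false (<⇒≤ u<v) = sym (+-identityʳ _)
  ... | tri> _ _ v<u rewrite <⇒<ᵇ≡true v<u | ≥⇒<ᵇ≡false (<⇒≤ v<u) | adj-sym G u v = refl
  ... | tri≈ _ u≡v _ rewrite FP.toℕ-injective u≡v | adj-irr G v | ≥⇒<ᵇ≡false (≤-refl {toℕ v}) = refl

dartCount-≤ : ∀ {N} (G : Graph N) → dartCount G ≤ N * (N ∸ 1)
dartCount-≤ {N} G = begin
  dartCount G
    ≤⟨ Σfin-mono N (λ u → Σfin-mono N (indicator-≤ u)) ⟩
  Σfin N (λ u → Σfin N (λ v → indicator (not (toℕ u ≡ᵇ toℕ v))))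
    ≡⟨ Σfin-cong N (λ u → trans (Σfin-toℕ N _) (count-≢ N (toℕ u) (FP.toℕ<n u))) ⟩
  Σfin N (λ _ → N ∸ 1)
    ≡⟨ Σfin-const N (N ∸ 1) ⟩
  N * (N ∸ 1)
    ∎
  where
  open ≤-Reasoning
  indicator-≤ : ∀ u v → indicator (adj G u v) ≤ indicator (not (toℕ u ≡ᵇ toℕ v))
  indicator-≤ u v with toℕ u ≡ᵇ toℕ v in e
  indicator-≤ u v | false with adj G u v
  ... | true  = ≤-refl
  ... | false = z≤n
  indicator-≤ u v | true with FP.toℕ-injective {i = u} {j = v} (≡ᵇ⇒≡ _ _ (subst T (sym e) tt))
  ... | refl rewrite adj-irr G u = z≤n

dartCount-≤-injection : ∀ {N K} (G : Graph N) (f : Dart G → Fin K) →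
                        (∀ {d d′} → f d ≡ f d′ → d ≡ d′) → dartCount G ≤ K
dartCount-≤-injection {N} {K} G f f-inj = begin
  dartCount G
    ≡⟨ Σfin-cong N (λ u → Σfin-cong N (cong (indicator ∘ uncurriedAdj) ∘ FP.remQuot-combine u)) ⟨
  Σfin N (λ u → Σfin N (λ v → indicator (P (F.combine u v))))
    ≡⟨ Σfin-combine N N (indicator ∘ P) ⟩
  Σfin (N * N) (indicator ∘ P)
    ≤⟨ count-injection (N * N) K P ι ι-inj ⟩
  K
    ∎
  where
  open ≤-Reasoning
  uncurriedAdj : Fin N × Fin N → Bool
  uncurriedAdj (u , v) = adj G u v
  P : Fin (N * N) → Bool
  P k = uncurriedAdj (F.remQuot {N} N k)
  ι : ∀ k → T (P k) → Fin K
  ι k p = f (dart (proj₁ (F.remQuot {N} N k)) (proj₂ (F.remQuot {N} N k)) p)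
  ι-inj : ∀ {k l p q} → ι k p ≡ ι l q → k ≡ l
  ι-inj {k} {l} eq = trans (sym (FP.combine-remQuot {N} N k))
    (trans (cong₂ F.combine (cong tl d≡d′) (cong hd d≡d′)) (FP.combine-remQuot {N} N l))
    where d≡d′ = f-inj eq

Reach-snoc : ∀ {N} {G : Graph N} {a b c} → Reach G a b → T (adj G b c) → Reach G a c
Reach-snoc here        bc = step bc here
Reach-snoc (step ab p) bc = step ab (Reach-snoc p bc)

Reach-sym : ∀ {N} {G : Graph N} {a b} → Reach G a b → Reach G b a
Reach-sym         here                = here
Reach-sym {G = G} (step {u} {w} uw p) = Reach-snoc (Reach-sym p) (subst T (adj-sym G u w) uw)

Reach-trans : ∀ {N} {G : Graph N} {a b c} → Reach G a b → Reach G b c → Reach G a c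
Reach-trans here        q = q
Reach-trans (step ab p) q = step ab (Reach-trans p q)

distinct-images⇒≤ : ∀ {k j} (f : Fin k → Fin j) → (∀ {x y} → x ≢ y → f x ≢ f y) → k ≤ j
distinct-images⇒≤ f f-≢ = FP.injective⇒≤ injective
  where
  injective : ∀ {x y} → f x ≡ f y → x ≡ y
  injective {x} {y} fx≡fy with x FP.≟ y
  ... | yes x≡y = x≡y
  ... | no  x≢y = ⊥-elim (f-≢ x≢y fx≡fy)

clique⇒colours-≥ : ∀ {N k j} (G : Graph N) (f : Fin k → Fin N) →
                   (∀ {x y} → x ≢ y → T (adj G (f x) (f y))) → ProperColoring G j → k ≤ j
clique⇒colours-≥ G f clique (c , proper) = distinct-images⇒≤ (c ∘ f) (λ x≢y → proper _ _ (clique x≢y))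

two-distinct⇒2≤ : ∀ {j} {a b : Fin j} → a ≢ b → 2 ≤ j
two-distinct⇒2≤ {suc (suc _)}        _   = s≤s (s≤s z≤n)
two-distinct⇒2≤ {suc zero} {fz} {fz} a≢b = ⊥-elim (a≢b refl)

three-distinct⇒3≤ : ∀ {j} {a b c : Fin j} → a ≢ b → a ≢ c → b ≢ c → 3 ≤ j
three-distinct⇒3≤ {suc j} a≢b a≢c b≢c =
  s≤s (two-distinct⇒2≤ {a = F.punchOut a≢b} {b = F.punchOut a≢c} (b≢c ∘ FP.punchOut-injective a≢b a≢c))

-- Quadrangulations

faceStep : ∀ {N} {H : Graph N} {g} → Quadrangulation H g → Dart H → Dart H
faceStep Q d = σ Q (rev d)

darts-≤-4faces : ∀ {N} {H : Graph N} {g} (Q : Quadrangulation H g) → dartCount H ≤ faces Q * 4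
darts-≤-4faces {H = H} Q = dartCount-≤-injection H code code-injective
  where
  representative : Fin (faces Q) → Dart H
  representative f = proj₁ (face-surj Q f)
  orbit : ∀ d → ∃ λ k → iter k (faceStep Q) (representative (face Q d)) ≡ d
  orbit d = face-orb₁ Q _ d (proj₂ (face-surj Q (face Q d)))
  offset : Dart H → ℕ
  offset d = proj₁ (orbit d) % 4
  offset-spec : ∀ d → iter (offset d) (faceStep Q) (representative (face Q d)) ≡ d
  offset-spec d = trans (iter-mod 4 (faceStep Q) _ (quad-len Q _) (proj₁ (orbit d))) (proj₂ (orbit d))
  code : Dart H → Fin (faces Q * 4)
  code d = F.combine (face Q d) (fromℕ< (m%n<n (proj₁ (orbit d)) 4))
  code-injective : ∀ {d d′} → code d ≡ code d′ → d ≡ d′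
  code-injective {d} {d′} eq with FP.combine-injective (face Q d) _ (face Q d′) _ eq
  ... | same-face , same-offset = begin
    d                                                          ≡⟨ offset-spec d ⟨
    iter (offset d) (faceStep Q) (representative (face Q d))   ≡⟨ cong₂ (λ k f → iter k (faceStep Q) (representative f))
                                                                        offset≡ same-face ⟩
    iter (offset d′) (faceStep Q) (representative (face Q d′)) ≡⟨ offset-spec d′ ⟩
    d′                                                         ∎
    where
    open ≡-Reasoning
    offset≡ : offset d ≡ offset d′
    offset≡ = trans (sym (FP.toℕ-fromℕ< _)) (trans (cong toℕ same-offset) (FP.toℕ-fromℕ< _))

-- Euler's formula together with 2E ≤ 4F (every face is a 4-cycle) and E ≤ N(N-1)/2.
quadrangulation-bound : ∀ {N} {H : Graph N} {g} → Quadrangulation H g → 4 * N + 8 * g ≤ 8 + N * (N ∸ 1)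
quadrangulation-bound {N} {H} {g} Q =
  ≤-trans (+-cancelʳ-≤ (F * 4) (4 * N + 8 * g) (8 + D) with-faces) (+-monoʳ-≤ 8 (dartCount-≤ H))
  where
  open ≤-Reasoning
  E = numEdges H
  D = dartCount H
  F = faces Q
  with-faces : 4 * N + 8 * g + F * 4 ≤ 8 + D + F * 4
  with-faces = begin
    4 * N + 8 * g + F * 4 ≡⟨ solve 3 (λ N g F → con 4 :* N :+ con 8 :* g :+ F :* con 4
                                              := con 4 :* (N :+ F :+ con 2 :* g)) refl N g F ⟩
    4 * (N + F + 2 * g)   ≡⟨ cong (4 *_) (euler Q) ⟩
    4 * (2 + E)           ≡⟨ solve 1 (λ E → con 4 :* (con 2 :+ E) := con 8 :+ con 2 :* E :+ con 2 :* E) refl E ⟩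
    8 + 2 * E + 2 * E     ≡⟨ cong₂ (λ x y → 8 + x + y) (handshake H) (handshake H) ⟩
    8 + D + D             ≤⟨ +-monoʳ-≤ (8 + D) (darts-≤-4faces Q) ⟩
    8 + D + F * 4         ∎

FacesAdjacent : ∀ {N} {H : Graph N} {g} (Q : Quadrangulation H g) → Fin (faces Q) → Fin (faces Q) → Set
FacesAdjacent {H = H} Q f f′ = Σ (Dart H) λ d → face Q d ≡ f × face Q (rev d) ≡ f′

adjacent-colours-≢ : ∀ {N} {H : Graph N} {g j} {Q : Quadrangulation H g} {f f′} →
                     FacesAdjacent Q f f′ → ((c , _) : FaceColoring Q j) → c f ≢ c f′
adjacent-colours-≢ (d , refl , refl) (c , proper) = proper d

faceColouring-2≤ : ∀ {N} {H : Graph N} {g j} {Q : Quadrangulation H g} {f f′} →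
                   FacesAdjacent Q f f′ → FaceColoring Q j → 2 ≤ j
faceColouring-2≤ {Q = Q} ff′ c = two-distinct⇒2≤ (adjacent-colours-≢ {Q = Q} ff′ c)

faceColouring-3≤ : ∀ {N} {H : Graph N} {g j} {Q : Quadrangulation H g} {f f′ f″} →
                   FacesAdjacent Q f f′ → FacesAdjacent Q f f″ → FacesAdjacent Q f′ f″ →
                   FaceColoring Q j → 3 ≤ j
faceColouring-3≤ {Q = Q} ff′ ff″ f′f″ c = three-distinct⇒3≤
  (adjacent-colours-≢ {Q = Q} ff′ c) (adjacent-colours-≢ {Q = Q} ff″ c) (adjacent-colours-≢ {Q = Q} f′f″ c)

-- Interlacements

base-↑ˡ : ∀ {n} (v : Fin n) → base {n} (v ↑ˡ n) ≡ v
base-↑ˡ {n} v rewrite FP.splitAt-↑ˡ n v n = refl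

base-↑ʳ : ∀ {n} (v : Fin n) → base {n} (n ↑ʳ v) ≡ v
base-↑ʳ {n} v rewrite FP.splitAt-↑ʳ n n v = refl

Σfin-base : ∀ n (f : Fin n → ℕ) → Σfin (n + n) (f ∘ base {n}) ≡ Σfin n f + Σfin n f
Σfin-base n f = trans (Σfin-split n n (f ∘ base {n}))
  (cong₂ _+_ (Σfin-cong n (cong f ∘ base-↑ˡ)) (Σfin-cong n (cong f ∘ base-↑ʳ)))

dartCount-interlace : ∀ {n} (G : Graph n) → dartCount (interlace G) ≡ 2 * (2 * dartCount G)
dartCount-interlace {n} G = begin
  dartCount (interlace G)
    ≡⟨ Σfin-cong (n + n) (λ i → Σfin-base n (row (base i))) ⟩
  Σfin (n + n) (λ i → twice (base i))
    ≡⟨ Σfin-base n twice ⟩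
  Σfin n twice + Σfin n twice
    ≡⟨ cong₂ _+_ (Σfin-+ n _ _) (Σfin-+ n _ _) ⟩
  (D + D) + (D + D)
    ≡⟨ solve 1 (λ D → (D :+ D) :+ (D :+ D) := con 2 :* (con 2 :* D)) refl D ⟩
  2 * (2 * D)
    ∎
  where
  open ≡-Reasoning
  row : Fin n → Fin n → ℕ
  row u v = indicator (adj G u v)
  twice : Fin n → ℕ
  twice u = Σfin n (row u) + Σfin n (row u)
  D = dartCount G

numEdges-interlace : ∀ {n} (G : Graph n) → numEdges (interlace G) ≡ 2 * dartCount G
numEdges-interlace G = *-cancelˡ-≡ _ _ 2 (trans (handshake (interlace G)) (dartCount-interlace G))

interlace-colouring : ∀ {n k} {G : Graph n} → ProperColoring G k → ProperColoring (interlace G) k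
interlace-colouring (c , proper) = c ∘ base , λ i j → proper (base i) (base j)

interlace-colouring⁻¹ : ∀ {n k} {G : Graph n} → ProperColoring (interlace G) k → ProperColoring G k
interlace-colouring⁻¹ {n} {G = G} (c , proper) = (λ v → c (v ↑ˡ n)) , λ u v uv →
  proper (u ↑ˡ n) (v ↑ˡ n) (subst₂ (λ x y → T (adj G x y)) (sym (base-↑ˡ u)) (sym (base-↑ˡ v)) uv)

interlace-chromatic : ∀ {n k} {G : Graph n} → IsChromaticNumber G k → IsChromaticNumber (interlace G) k
interlace-chromatic {G = G} (colouring , fewer) =
  interlace-colouring {G = G} colouring , λ j j<k → fewer j j<k ∘ interlace-colouring⁻¹ {G = G}

interlace-connected : ∀ {n} (G : Graph n) (h w : Fin n) → w ≢ h →
                      (∀ v → v ≢ h → T (adj G v h)) → Connected (interlace G)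
interlace-connected {n} G h w w≢h dominating i j =
  Reach-trans (to-hub i) (Reach-sym (to-hub j))
  where
  to-hub : ∀ i → Reach (interlace G) i (h ↑ˡ n)
  to-hub i with base i FP.≟ h
  ... | no  i≢h  = step (subst (T ∘ adj G (base i)) (sym (base-↑ˡ h)) (dominating (base i) i≢h)) here
  ... | yes refl = step (subst (T ∘ adj G h) (sym (base-↑ˡ w)) (subst T (adj-sym G w h) (dominating w w≢h)))
                        (step (subst₂ (λ x y → T (adj G x y)) (sym (base-↑ˡ w)) (sym (base-↑ˡ h))
                                      (dominating w w≢h)) here)

-- Rotation systems and the twisted rotation of their interlacement

PairwiseDistinct₄ : ∀ {X : Set} → (ℕ → X) → Set
PairwiseDistinct₄ g = (g 0 ≢ g 1) × (g 0 ≢ g 2) × (g 0 ≢ g 3) × (g 1 ≢ g 2) × (g 1 ≢ g 3) × (g 2 ≢ g 3)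

private
  pairwise-distinct₄-< : ∀ {X : Set} {g : ℕ → X} → PairwiseDistinct₄ g → ∀ i j → i < j → j < 4 → g i ≢ g j
  pairwise-distinct₄-< (d01 , _)                      0 1 _ _ = d01
  pairwise-distinct₄-< (_ , d02 , _)                  0 2 _ _ = d02
  pairwise-distinct₄-< (_ , _ , d03 , _)              0 3 _ _ = d03
  pairwise-distinct₄-< (_ , _ , _ , d12 , _)          1 2 _ _ = d12
  pairwise-distinct₄-< (_ , _ , _ , _ , d13 , _)      1 3 _ _ = d13
  pairwise-distinct₄-< (_ , _ , _ , _ , _ , d23)      2 3 _ _ = d23
  pairwise-distinct₄-< _ _ (suc (suc (suc (suc _)))) _ (s≤s (s≤s (s≤s (s≤s ()))))
  pairwise-distinct₄-< _ (suc _)             1 (s≤s ())                   _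
  pairwise-distinct₄-< _ (suc (suc _))       2 (s≤s (s≤s ()))             _
  pairwise-distinct₄-< _ (suc (suc (suc _))) 3 (s≤s (s≤s (s≤s ())))       _

pairwise-distinct₄ : ∀ {X : Set} {g : ℕ → X} → PairwiseDistinct₄ g →
                     ∀ i j → i < 4 → j < 4 → i ≢ j → g i ≢ g j
pairwise-distinct₄ d i j i<4 j<4 i≢j with <-cmp i j
... | tri< i<j _ _ = pairwise-distinct₄-< d i j i<j j<4
... | tri≈ _ i≡j _ = ⊥-elim (i≢j i≡j)
... | tri> _ _ j<i = pairwise-distinct₄-< d j i j<i i<4 ∘ sym

Edge : ℕ → (ℕ → ℕ → Bool) → ℕ → ℕ → Set
Edge n A u v = u < n × v < n × T (A u v)

record Rotation (n : ℕ) (A : ℕ → ℕ → Bool) : Set where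
  field
    symmetric    : ∀ {u v} → T (A u v) → T (A v u)
    irreflexive  : ∀ {u v} → T (A u v) → u ≢ v
    ρ ρ⁻¹        : ℕ → ℕ → ℕ
    ρ-edge       : ∀ {u v} → Edge n A u v → Edge n A u (ρ u v)
    ρ⁻¹-edge     : ∀ {u v} → Edge n A u v → Edge n A u (ρ⁻¹ u v)
    ρ-ρ⁻¹        : ∀ {u v} → Edge n A u v → ρ u (ρ⁻¹ u v) ≡ v
    ρ⁻¹-ρ        : ∀ {u v} → Edge n A u v → ρ⁻¹ u (ρ u v) ≡ v
    ρ-transitive : ∀ {u v w} → Edge n A u v → Edge n A u w → ∃ λ t → iter t (ρ u) v ≡ w

-- arc s u t v runs from the copy s of u to the copy t of v (false for v′, true for v″).
data Arc : Set where
  arc : Bool → ℕ → Bool → ℕ → Arc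

reverse : Arc → Arc
reverse (arc s u t v) = arc t v s u

origin : Arc → Bool × ℕ
origin (arc s u _ _) = s , u

≢-base : ∀ {b : Bool} {u v : ℕ} → u ≢ v → (b , u) ≢ (b , v)
≢-base u≢v = u≢v ∘ cong proj₂

module Interlacement {n A} (R : Rotation n A) where
  open Rotation R public

  _~_ : ℕ → ℕ → Set
  u ~ v = Edge n A u v

  ~-sym : ∀ {u v} → u ~ v → v ~ u
  ~-sym (u<n , v<n , uv) = v<n , u<n , symmetric uv

  ~-irrefl : ∀ {u v} → u ~ v → u ≢ v
  ~-irrefl (_ , _ , uv) = irreflexive uv

  ρ-≢ : ∀ {u v} → u ~ v → ρ u v ≢ u
  ρ-≢ uv = ~-irrefl (ρ-edge uv) ∘ sym

  ρ⁻¹-≢ : ∀ {u v} → u ~ v → ρ⁻¹ u v ≢ u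
  ρ⁻¹-≢ uv = ~-irrefl (ρ⁻¹-edge uv) ∘ sym

  iter-ρ⁻¹-ρ : ∀ {u v} → u ~ v → ∀ t → iter t (ρ⁻¹ u) (iter t (ρ u) v) ≡ v
  iter-ρ⁻¹-ρ uv zero = refl
  iter-ρ⁻¹-ρ {u} {v} uv (suc t) = begin
    iter (suc t) (ρ⁻¹ u) (ρ u (iter t (ρ u) v))   ≡⟨ iter-suc t (ρ⁻¹ u) _ ⟩
    iter t (ρ⁻¹ u) (ρ⁻¹ u (ρ u (iter t (ρ u) v))) ≡⟨ cong (iter t (ρ⁻¹ u))
                                                         (ρ⁻¹-ρ (iter-preserves (u ~_) (ρ u) ρ-edge t uv)) ⟩
    iter t (ρ⁻¹ u) (iter t (ρ u) v)               ≡⟨ iter-ρ⁻¹-ρ uv t ⟩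
    v                                             ∎
    where open ≡-Reasoning

  ρ⁻¹-transitive : ∀ {u v w} → u ~ v → u ~ w → ∃ λ t → iter t (ρ⁻¹ u) v ≡ w
  ρ⁻¹-transitive {u} uv uw with ρ-transitive uw uv
  ... | t , ρᵗw≡v = t , trans (cong (iter t (ρ⁻¹ u)) (sym ρᵗw≡v)) (iter-ρ⁻¹-ρ uw t)

  ValidArc : Arc → Set
  ValidArc (arc _ u _ v) = u ~ v

  -- Around u′ the arcs are met in the order u′v′, u′v″, u′w′, u′w″, … with w = ρ⁻¹ u v;
  -- around u″ the neighbours are visited in the opposite sense.
  rotate : Arc → Arc
  rotate (arc false u false v) = arc false u true v
  rotate (arc false u true  v) = arc false u false (ρ⁻¹ u v)
  rotate (arc true  u true  v) = arc true u false v
  rotate (arc true  u false v) = arc true u true (ρ u v)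

  rotate⁻¹ : Arc → Arc
  rotate⁻¹ (arc false u true  v) = arc false u false v
  rotate⁻¹ (arc false u false v) = arc false u true (ρ u v)
  rotate⁻¹ (arc true  u false v) = arc true u true v
  rotate⁻¹ (arc true  u true  v) = arc true u false (ρ⁻¹ u v)

  φ : Arc → Arc
  φ = rotate ∘ reverse

  rotate-valid : ∀ x → ValidArc x → ValidArc (rotate x)
  rotate-valid (arc false _ false _) uv = uv
  rotate-valid (arc false _ true  _) uv = ρ⁻¹-edge uv
  rotate-valid (arc true  _ true  _) uv = uv
  rotate-valid (arc true  _ false _) uv = ρ-edge uv

  rotate⁻¹-valid : ∀ x → ValidArc x → ValidArc (rotate⁻¹ x)
  rotate⁻¹-valid (arc false _ true  _) uv = uv
  rotate⁻¹-valid (arc false _ false _) uv = ρ-edge uv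
  rotate⁻¹-valid (arc true  _ false _) uv = uv
  rotate⁻¹-valid (arc true  _ true  _) uv = ρ⁻¹-edge uv

  reverse-valid : ∀ x → ValidArc x → ValidArc (reverse x)
  reverse-valid (arc _ _ _ _) = ~-sym

  φ-valid : ∀ x → ValidArc x → ValidArc (φ x)
  φ-valid x = rotate-valid (reverse x) ∘ reverse-valid x

  rotate⁻¹-rotate : ∀ x → ValidArc x → rotate⁻¹ (rotate x) ≡ x
  rotate⁻¹-rotate (arc false u false v) uv = refl
  rotate⁻¹-rotate (arc false u true  v) uv = cong (arc false u true) (ρ-ρ⁻¹ uv)
  rotate⁻¹-rotate (arc true  u true  v) uv = refl
  rotate⁻¹-rotate (arc true  u false v) uv = cong (arc true u false) (ρ⁻¹-ρ uv)

  rotate-rotate⁻¹ : ∀ x → ValidArc x → rotate (rotate⁻¹ x) ≡ x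
  rotate-rotate⁻¹ (arc false u true  v) uv = refl
  rotate-rotate⁻¹ (arc false u false v) uv = cong (arc false u false) (ρ⁻¹-ρ uv)
  rotate-rotate⁻¹ (arc true  u false v) uv = refl
  rotate-rotate⁻¹ (arc true  u true  v) uv = cong (arc true u true) (ρ-ρ⁻¹ uv)

  origin-rotate : ∀ x → origin (rotate x) ≡ origin x
  origin-rotate (arc false _ false _) = refl
  origin-rotate (arc false _ true  _) = refl
  origin-rotate (arc true  _ true  _) = refl
  origin-rotate (arc true  _ false _) = refl

  iter-rotate-′ : ∀ u v t → iter (t + t) rotate (arc false u false v) ≡ arc false u false (iter t (ρ⁻¹ u) v)
  iter-rotate-′ u v zero = refl
  iter-rotate-′ u v (suc t) rewrite +-suc t t | iter-rotate-′ u v t = refl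

  iter-rotate-″ : ∀ u v t → iter (t + t) rotate (arc true u true v) ≡ arc true u true (iter t (ρ u) v)
  iter-rotate-″ u v zero = refl
  iter-rotate-″ u v (suc t) rewrite +-suc t t | iter-rotate-″ u v t = refl

  rotate-reaches-′ : ∀ {u v w} b → u ~ v → u ~ w →
                     ∃ λ k → iter k rotate (arc false u false v) ≡ arc false u b w
  rotate-reaches-′ {u} {v} b uv uw with ρ⁻¹-transitive uv uw
  rotate-reaches-′ {u} {v} false uv uw | t , eq =
    t + t , trans (iter-rotate-′ u v t) (cong (arc false u false) eq)
  rotate-reaches-′ {u} {v} true  uv uw | t , eq =
    suc (t + t) , cong rotate (trans (iter-rotate-′ u v t) (cong (arc false u false) eq))

  rotate-reaches-″ : ∀ {u v w} b → u ~ v → u ~ w →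
                     ∃ λ k → iter k rotate (arc true u true v) ≡ arc true u b w
  rotate-reaches-″ {u} {v} b uv uw with ρ-transitive uv uw
  rotate-reaches-″ {u} {v} true  uv uw | t , eq =
    t + t , trans (iter-rotate-″ u v t) (cong (arc true u true) eq)
  rotate-reaches-″ {u} {v} false uv uw | t , eq =
    suc (t + t) , cong rotate (trans (iter-rotate-″ u v t) (cong (arc true u true) eq))

  rotate-transitive : ∀ x y → ValidArc x → ValidArc y → origin x ≡ origin y → ∃ λ k → iter k rotate x ≡ y
  rotate-transitive (arc false u false v) (arc .false .u b w) uv uw refl = rotate-reaches-′ b uv uw
  rotate-transitive (arc true  u true  v) (arc .true  .u b w) uv uw refl = rotate-reaches-″ b uv uw
  rotate-transitive (arc false u true  v) (arc .false .u b w) uv uw refl with rotate-reaches-′ b (ρ⁻¹-edge uv) uw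
  ... | k , eq = k + 1 , trans (iter-+ k 1 rotate _) eq
  rotate-transitive (arc true  u false v) (arc .true  .u b w) uv uw refl with rotate-reaches-″ b (ρ-edge uv) uw
  ... | k , eq = k + 1 , trans (iter-+ k 1 rotate _) eq

  φ⁴ : ∀ x → ValidArc x → iter 4 φ x ≡ x
  φ⁴ (arc false u false v) uv = cong (arc false u false) (ρ⁻¹-ρ uv)
  φ⁴ (arc false v true  u) vu = cong (λ z → arc false z true u) (ρ⁻¹-ρ (~-sym vu))
  φ⁴ (arc true  u true  w) uw = cong (arc true u true) (ρ-ρ⁻¹ uw)
  φ⁴ (arc true  w false u) wu = cong (λ z → arc true z false u) (ρ-ρ⁻¹ (~-sym wu))

  -- The φ-orbit of u′v′ is the 4-cycle u′ v′ u″ (ρ u v)″, so faces correspond to the corners (u, v) of R.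
  corner : Arc → ℕ × ℕ
  corner (arc false u false v) = u , v
  corner (arc false v true  u) = u , v
  corner (arc true  u true  w) = u , ρ⁻¹ u w
  corner (arc true  w false u) = u , ρ⁻¹ u w

  cornerArc : ℕ × ℕ → Arc
  cornerArc (u , v) = arc false u false v

  corner-edge : ∀ x → ValidArc x → uncurry _~_ (corner x)
  corner-edge (arc false _ false _) uv = uv
  corner-edge (arc false _ true  _) vu = ~-sym vu
  corner-edge (arc true  _ true  _) uw = ρ⁻¹-edge uw
  corner-edge (arc true  _ false _) wu = ρ⁻¹-edge (~-sym wu)

  corner-φ : ∀ x → ValidArc x → corner (φ x) ≡ corner x
  corner-φ (arc false _ false _) _  = refl
  corner-φ (arc false v true  u) vu = cong (u ,_) (ρ⁻¹-ρ (~-sym vu))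
  corner-φ (arc true  _ true  _) _  = refl
  corner-φ (arc true  _ false _) _  = refl

  corner-reverse-~ : ∀ x → ValidArc x → proj₁ (corner x) ~ proj₁ (corner (reverse x))
  corner-reverse-~ (arc false _ false _) uv = uv
  corner-reverse-~ (arc false _ true  _) vu = ~-sym vu
  corner-reverse-~ (arc true  _ true  _) uw = uw
  corner-reverse-~ (arc true  _ false _) wu = ~-sym wu

  φ-from-corner : ∀ x → ValidArc x → ∃ λ r → iter r φ (cornerArc (corner x)) ≡ x
  φ-from-corner (arc false _ false _) _  = 0 , refl
  φ-from-corner (arc false _ true  _) _  = 1 , refl
  φ-from-corner (arc true  u true  _) uw = 2 , cong (arc true u true) (ρ-ρ⁻¹ uw)
  φ-from-corner (arc true  _ false u) wu = 3 , cong (λ z → arc true z false u) (ρ-ρ⁻¹ (~-sym wu))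

  iter-φ-undo : ∀ r y → ValidArc y → iter (3 * r) φ (iter r φ y) ≡ y
  iter-φ-undo zero    y _  = refl
  iter-φ-undo (suc r) y vy = begin
    iter (3 * suc r) φ (iter (suc r) φ y)   ≡⟨ cong₂ (λ k z → iter k φ z) (*-suc 3 r) (iter-suc r φ y) ⟩
    iter (3 + 3 * r) φ (iter r φ (φ y))     ≡⟨ iter-+ 3 (3 * r) φ _ ⟩
    iter 3 φ (iter (3 * r) φ (iter r φ (φ y))) ≡⟨ cong (iter 3 φ) (iter-φ-undo r (φ y) (φ-valid y vy)) ⟩
    iter 3 φ (φ y)                          ≡⟨ iter-suc 3 φ y ⟨
    iter 4 φ y                              ≡⟨ φ⁴ y vy ⟩
    y                                       ∎
    where open ≡-Reasoning

  same-corner⇒same-face : ∀ x y → ValidArc x → ValidArc y → corner x ≡ corner y → ∃ λ k → iter k φ x ≡ y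
  same-corner⇒same-face x y vx vy same with φ-from-corner x vx | φ-from-corner y vy
  ... | r , φʳc≡x | r′ , φʳ′c≡y = r′ + 3 * r , (begin
    iter (r′ + 3 * r) φ x                         ≡⟨ iter-+ r′ (3 * r) φ x ⟩
    iter r′ φ (iter (3 * r) φ x)                  ≡⟨ cong (iter r′ φ ∘ iter (3 * r) φ) φʳc≡x ⟨
    iter r′ φ (iter (3 * r) φ (iter r φ c))       ≡⟨ cong (iter r′ φ) (iter-φ-undo r _ (corner-edge x vx)) ⟩
    iter r′ φ c                                   ≡⟨ cong (iter r′ φ ∘ cornerArc) same ⟩
    iter r′ φ (cornerArc (corner y))              ≡⟨ φʳ′c≡y ⟩
    y                                             ∎)
    where
    open ≡-Reasoning
    c = cornerArc (corner x)

  φ-origins-distinct : ∀ x → ValidArc x → PairwiseDistinct₄ (λ i → origin (iter i φ x))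
  φ-origins-distinct (arc false _ false _) uv =
    ≢-base (~-irrefl uv) , (λ ()) , (λ ()) , (λ ()) , (λ ()) , ≢-base (ρ-≢ uv ∘ sym)
  φ-origins-distinct (arc false _ true  _) vu =
    (λ ()) , (λ ()) , ≢-base (~-irrefl vu) , ≢-base (ρ-≢ (~-sym vu) ∘ sym) , (λ ()) , (λ ())
  φ-origins-distinct (arc true  _ true  _) uw =
    ≢-base (~-irrefl uw) , (λ ()) , (λ ()) , (λ ()) , (λ ()) , ≢-base (ρ⁻¹-≢ uw ∘ sym)
  φ-origins-distinct (arc true  _ false _) wu =
    (λ ()) , (λ ()) , ≢-base (~-irrefl wu) , ≢-base (ρ⁻¹-≢ (~-sym wu) ∘ sym) , (λ ()) , (λ ())

-- The genus

triangular : ℕ → ℕ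
triangular zero    = 0
triangular (suc b) = suc b + triangular b

2*triangular : ∀ b → 2 * triangular b ≡ b * suc b
2*triangular zero    = refl
2*triangular (suc b) = begin
  2 * (suc b + triangular b)       ≡⟨ *-distribˡ-+ 2 (suc b) (triangular b) ⟩
  2 * suc b + 2 * triangular b     ≡⟨ cong (2 * suc b +_) (2*triangular b) ⟩
  2 * suc b + b * suc b            ≡⟨ solve 1 (λ b → con 2 :* (con 1 :+ b) :+ b :* (con 1 :+ b)
                                                   := (con 1 :+ b) :* (con 2 :+ b)) refl b ⟩
  suc b * suc (suc b)              ∎
  where open ≡-Reasoning

data Shape : ℕ → ℕ → Set where
  shape : ∀ a b → Shape (2 + a + b) (suc a)

shape? : ∀ {n m} → 1 ≤ m → m < n → Shape n m
shape? {m = suc a} _ m<n with m≤n⇒∃[o]m+o≡n m<n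
... | b , refl = shape a b

genus-value : ∀ a b → genusFormula (2 + a + b) (suc a) ≡ a * b + triangular b
genus-value a b = begin
  (suc (a + b) * (a + b) ∸ suc a * a) / 2              ≡⟨ cong (λ x → (x ∸ suc a * a) / 2) expand ⟩
  (suc a * a + (a * b + triangular b) * 2 ∸ suc a * a) / 2 ≡⟨ cong (_/ 2) (m+n∸m≡n (suc a * a) _) ⟩
  (a * b + triangular b) * 2 / 2                      ≡⟨ m*n/n≡m (a * b + triangular b) 2 ⟩
  a * b + triangular b                                ∎
  where
  open ≡-Reasoning
  expand : suc (a + b) * (a + b) ≡ suc a * a + (a * b + triangular b) * 2
  expand = begin
    suc (a + b) * (a + b)
      ≡⟨ solve 2 (λ a b → (con 1 :+ (a :+ b)) :* (a :+ b)
                          := (con 1 :+ a) :* a :+ (con 2 :* (a :* b) :+ b :* (con 1 :+ b))) refl a b ⟩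
    suc a * a + (2 * (a * b) + b * suc b)
      ≡⟨ cong (λ t → suc a * a + (2 * (a * b) + t)) (2*triangular b) ⟨
    suc a * a + (2 * (a * b) + 2 * triangular b)
      ≡⟨ solve 3 (λ a b t → (con 1 :+ a) :* a :+ (con 2 :* (a :* b) :+ con 2 :* t)
                            := (con 1 :+ a) :* a :+ (a :* b :+ t) :* con 2) refl a b (triangular b) ⟩
    suc a * a + (a * b + triangular b) * 2
      ∎

cornerCount : ℕ → ℕ → ℕ
cornerCount m n = m * (n ∸ m) + (n ∸ m) * (n ∸ 1)

cornerCount-value : ∀ a b → cornerCount (suc a) (2 + a + b) ≡ suc a * suc b + suc b * suc (a + b)
cornerCount-value a b =
  cong (λ x → suc a * x + x * suc (a + b)) (trans (cong (_∸ a) (sym (+-suc a b))) (m+n∸m≡n a (suc b)))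

-- Euler's formula for V = 2n, F = cornerCount m n = 2|E(G)| and E = 2F, i.e. g = |E(G)| − n + 1.
euler-count : ∀ {n m} → 1 ≤ m → m < n →
              n + n + cornerCount m n + 2 * genusFormula n m ≡ 2 + 2 * cornerCount m n
euler-count 1≤m m<n with shape? 1≤m m<n
... | shape a b = begin
  n + n + cornerCount m n + 2 * genusFormula n m
    ≡⟨ cong₂ (λ F g → n + n + F + 2 * g) (cornerCount-value a b) (genus-value a b) ⟩
  n + n + F + 2 * (a * b + triangular b)
    ≡⟨ cong (n + n + F +_) (*-distribˡ-+ 2 (a * b) (triangular b)) ⟩
  n + n + F + (2 * (a * b) + 2 * triangular b)
    ≡⟨ cong (λ t → n + n + F + (2 * (a * b) + t)) (2*triangular b) ⟩
  n + n + F + (2 * (a * b) + b * suc b)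
    ≡⟨ solve 2 (λ a b → (con 2 :+ a :+ b) :+ (con 2 :+ a :+ b) :+ F′ a b :+ (con 2 :* (a :* b) :+ b :* (con 1 :+ b))
                        := con 2 :+ con 2 :* F′ a b) refl a b ⟩
  2 + 2 * F
    ≡⟨ cong (λ F → 2 + 2 * F) (cornerCount-value a b) ⟨
  2 + 2 * cornerCount m n
    ∎
  where
  open ≡-Reasoning
  n = 2 + a + b
  m = suc a
  F = suc a * suc b + suc b * suc (a + b)
  F′ = λ a b → (con 1 :+ a) :* (con 1 :+ b) :+ (con 1 :+ b) :* (con 1 :+ (a :+ b))

quadratic-bound : ∀ N D → N ≤ 5 + D → N * (N ∸ 1) ≤ 4 * N + (5 + D) * D
quadratic-bound N D N≤5+D = begin
  N * (N ∸ 1)          ≤⟨ *-monoʳ-≤ N (∸-monoˡ-≤ 1 N≤5+D) ⟩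
  N * (4 + D)          ≡⟨ solve 2 (λ N D → N :* (con 4 :+ D) := con 4 :* N :+ N :* D) refl N D ⟩
  4 * N + N * D        ≤⟨ +-monoʳ-≤ (4 * N) (*-monoˡ-≤ D N≤5+D) ⟩
  4 * N + (5 + D) * D  ∎
  where open ≤-Reasoning

-- If N ≤ 2n − 1 = 5 + D, the bound forces 8g ≤ 8 + (5 + D)D, which 8g exceeds by 2k + 2.
genus-forces-vertices : ∀ {n m N} → 1 ≤ m → 4 + 2 * (m * (m ∸ 1)) ≤ n →
                        4 * N + 8 * genusFormula n m ≤ 8 + N * (N ∸ 1) → n + n ≤ N
genus-forces-vertices {m = suc a} {N} _ n-large bound with m≤n⇒∃[o]m+o≡n n-large
... | k , refl = ≮⇒≥ too-few
  where
  n = 4 + 2 * (suc a * a) + k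
  b = 2 + a + 2 * (a * a) + k
  D = 4 * (a * a) + 4 * a + 2 + 2 * k
  2n≡ : n + n ≡ suc (5 + D)
  2n≡ = solve 2 (λ a k → (con 4 :+ con 2 :* ((con 1 :+ a) :* a) :+ k) :+ (con 4 :+ con 2 :* ((con 1 :+ a) :* a) :+ k)
                         := con 1 :+ (con 5 :+ (con 4 :* (a :* a) :+ con 4 :* a :+ con 2 :+ con 2 :* k))) refl a k
  8g≡ : 8 * genusFormula n (suc a) ≡ 8 + (5 + D) * D + (2 + 2 * k)
  8g≡ = begin
    8 * genusFormula n (suc a)              ≡⟨ cong (λ x → 8 * genusFormula x (suc a)) n≡2+a+b ⟩
    8 * genusFormula (2 + a + b) (suc a)    ≡⟨ cong (8 *_) (genus-value a b) ⟩
    8 * (a * b + triangular b)              ≡⟨ solve 3 (λ a b t → con 8 :* (a :* b :+ t)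
                                                                  := con 8 :* (a :* b) :+ con 4 :* (con 2 :* t))
                                                       refl a b (triangular b) ⟩
    8 * (a * b) + 4 * (2 * triangular b)    ≡⟨ cong (λ t → 8 * (a * b) + 4 * t) (2*triangular b) ⟩
    8 * (a * b) + 4 * (b * suc b)           ≡⟨ solve 2 (λ a k → con 8 :* (a :* B a k) :+ con 4 :* (B a k :* (con 1 :+ B a k))
                                                             := con 8 :+ (con 5 :+ D′ a k) :* D′ a k :+ (con 2 :+ con 2 :* k))
                                                       refl a k ⟩
    8 + (5 + D) * D + (2 + 2 * k)           ∎
    where
    open ≡-Reasoning
    n≡2+a+b : n ≡ 2 + a + b
    n≡2+a+b = solve 2 (λ a k → con 4 :+ con 2 :* ((con 1 :+ a) :* a) :+ k
                               := con 2 :+ a :+ (con 2 :+ a :+ con 2 :* (a :* a) :+ k)) refl a k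
    B = λ a k → con 2 :+ a :+ con 2 :* (a :* a) :+ k
    D′ = λ a k → con 4 :* (a :* a) :+ con 4 :* a :+ con 2 :+ con 2 :* k
  too-few : N < n + n → ⊥
  too-few N<2n = <⇒≱ (m<m+n (8 + (5 + D) * D) {2 + 2 * k} (s≤s z≤n)) (subst (_≤ 8 + (5 + D) * D) 8g≡ 8g≤)
    where
    open ≤-Reasoning
    8g≤ : 8 * genusFormula n (suc a) ≤ 8 + (5 + D) * D
    8g≤ = +-cancelˡ-≤ (4 * N) _ _ (begin
      4 * N + 8 * genusFormula n (suc a) ≤⟨ bound ⟩
      8 + N * (N ∸ 1)                    ≤⟨ +-monoʳ-≤ 8 (quadratic-bound N D (s≤s⁻¹ (subst (N <_) 2n≡ N<2n))) ⟩
      8 + (4 * N + (5 + D) * D)          ≡⟨ solve 2 (λ x y → con 8 :+ (x :+ y) := x :+ (con 8 :+ y))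
                                                     refl (4 * N) ((5 + D) * D) ⟩
      4 * N + (8 + (5 + D) * D)          ∎)

-- The graph K_n − E(K_m)

-- Opaque, so that m, u and v can be inferred from T (kmAdj m u v).
opaque
  kmAdj : ℕ → ℕ → ℕ → Bool
  kmAdj m u v = not (u ≡ᵇ v) ∧ not ((u <ᵇ m) ∧ (v <ᵇ m))

opaque
  unfolding kmAdj

  KnMinusKm-adj : ∀ {n m} (u v : Fin n) → adj (KnMinusKm n m) u v ≡ kmAdj m (toℕ u) (toℕ v)
  KnMinusKm-adj u v = refl

  kmAdj-≢ : ∀ {m u v} → T (kmAdj m u v) → u ≢ v
  kmAdj-≢ {u = u} uv refl =
    subst T (Equivalence.to T-not-≡ (proj₁ (Equivalence.to T-∧ uv))) (≡⇒≡ᵇ u u refl)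

  kmAdj-inside : ∀ {m u v} → T (kmAdj m u v) → u < m → m ≤ v
  kmAdj-inside {m} {u} {v} uv u<m = <ᵇ≡false⇒≥ (subst (λ b → (b ∧ (v <ᵇ m)) ≡ false) (<⇒<ᵇ≡true u<m)
                                                      (Equivalence.to T-not-≡ (proj₂ (Equivalence.to T-∧ uv))))

  kmAdj-inside-≡ : ∀ {m u} v → u < m → kmAdj m u v ≡ not (v <ᵇ m)
  kmAdj-inside-≡ {m} {u} v u<m with v <ᵇ m in e
  ... | true  rewrite <⇒<ᵇ≡true u<m = ∧-zeroʳ _
  ... | false rewrite <⇒<ᵇ≡true u<m | ≢⇒≡ᵇ≡false {u} {v} (λ u≡v → <⇒≱ (subst (_< m) u≡v u<m) (<ᵇ≡false⇒≥ e))
    = refl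

  kmAdj-outside-≡ : ∀ {m u} v → m ≤ u → kmAdj m u v ≡ not (u ≡ᵇ v)
  kmAdj-outside-≡ {m} {u} v m≤u rewrite ≥⇒<ᵇ≡false m≤u = ∧-identityʳ _

  kmAdj-intro : ∀ {m u v} → u ≢ v → (u < m → m ≤ v) → T (kmAdj m u v)
  kmAdj-intro {m} {u} {v} u≢v inside with u <ᵇ m in e
  ... | true  rewrite ≢⇒≡ᵇ≡false u≢v | ≥⇒<ᵇ≡false (inside (<ᵇ≡true⇒< e)) = tt
  ... | false rewrite ≢⇒≡ᵇ≡false u≢v = tt

kmAdj-sym : ∀ {m u v} → T (kmAdj m u v) → T (kmAdj m v u)
kmAdj-sym uv = kmAdj-intro (kmAdj-≢ uv ∘ sym) (λ v<m → ≮⇒≥ (λ u<m → <⇒≱ v<m (kmAdj-inside uv u<m)))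

kmAdj-outside : ∀ {m u v} → m ≤ u → u ≢ v → T (kmAdj m u v)
kmAdj-outside m≤u u≢v = kmAdj-intro u≢v (λ u<m → ⊥-elim (<⇒≱ u<m m≤u))

data Position (m u : ℕ) : Set where
  inside  : u < m → Position m u
  outside : m ≤ u → Position m u

position : ∀ m u → Position m u
position m u with u <? m
... | yes u<m = inside u<m
... | no  u≮m = outside (≮⇒≥ u≮m)

skip : ℕ → ℕ → ℕ
skip u p = if p <ᵇ u then p else suc p

unskip : ℕ → ℕ → ℕ
unskip u v = if v <ᵇ u then v else v ∸ 1

skip-< : ∀ {u p} → p < u → skip u p ≡ p
skip-< {u} {p} p<u = cong (if_then p else suc p) (<⇒<ᵇ≡true p<u)

skip-≥ : ∀ {u p} → u ≤ p → skip u p ≡ suc p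
skip-≥ {u} {p} u≤p = cong (if_then p else suc p) (≥⇒<ᵇ≡false u≤p)

unskip-< : ∀ {u v} → v < u → unskip u v ≡ v
unskip-< {u} {v} v<u = cong (if_then v else v ∸ 1) (<⇒<ᵇ≡true v<u)

unskip-≥ : ∀ {u v} → u ≤ v → unskip u v ≡ v ∸ 1
unskip-≥ {u} {v} u≤v = cong (if_then v else v ∸ 1) (≥⇒<ᵇ≡false u≤v)

-- The rotation at every vertex lists its neighbours in increasing order, cyclically:
-- the p-th neighbour of u is m + p when u < m, and the p-th number other than u when u ≥ m.
module KmRotation (m n : ℕ) (1≤m : 1 ≤ m) (m<n : m < n) where

  _~_ : ℕ → ℕ → Set
  u ~ v = Edge n (kmAdj m) u v

  degree : ℕ → ℕ
  degree u = if u <ᵇ m then n ∸ m else n ∸ 1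

  neighbourAt : ℕ → ℕ → ℕ
  neighbourAt u p = if u <ᵇ m then m + p else skip u p

  indexOf : ℕ → ℕ → ℕ
  indexOf u v = if u <ᵇ m then v ∸ m else unskip u v

  degree-inside : ∀ {u} → u < m → degree u ≡ n ∸ m
  degree-inside u<m = cong (if_then n ∸ m else n ∸ 1) (<⇒<ᵇ≡true u<m)

  degree-outside : ∀ {u} → m ≤ u → degree u ≡ n ∸ 1
  degree-outside m≤u = cong (if_then n ∸ m else n ∸ 1) (≥⇒<ᵇ≡false m≤u)

  neighbourAt-inside : ∀ {u p} → u < m → neighbourAt u p ≡ m + p
  neighbourAt-inside {u} {p} u<m = cong (if_then m + p else skip u p) (<⇒<ᵇ≡true u<m)

  neighbourAt-outside : ∀ {u p} → m ≤ u → neighbourAt u p ≡ skip u p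
  neighbourAt-outside {u} {p} m≤u = cong (if_then m + p else skip u p) (≥⇒<ᵇ≡false m≤u)

  indexOf-inside : ∀ {u v} → u < m → indexOf u v ≡ v ∸ m
  indexOf-inside {u} {v} u<m = cong (if_then v ∸ m else unskip u v) (<⇒<ᵇ≡true u<m)

  indexOf-outside : ∀ {u v} → m ≤ u → indexOf u v ≡ unskip u v
  indexOf-outside {u} {v} m≤u = cong (if_then v ∸ m else unskip u v) (≥⇒<ᵇ≡false m≤u)

  0<n : 0 < n
  0<n = ≤-<-trans z≤n m<n

  indexOf-< : ∀ {u v} → u ~ v → indexOf u v < degree u
  indexOf-< {u} {v} (u<n , v<n , uv) with position m u
  ... | inside u<m rewrite degree-inside u<m | indexOf-inside {u} {v} u<m = ∸-monoˡ-< v<n (kmAdj-inside uv u<m)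
  ... | outside m≤u rewrite degree-outside m≤u | indexOf-outside {u} {v} m≤u with <-cmp v u
  ...   | tri< v<u _ _ rewrite unskip-< v<u = <-≤-trans v<u (<⇒≤pred u<n)
  ...   | tri≈ _ v≡u _ = ⊥-elim (kmAdj-≢ uv (sym v≡u))
  ...   | tri> _ _ u<v rewrite unskip-≥ (<⇒≤ u<v) = pred-mono-< ⦃ >-nonZero (≤-<-trans z≤n u<v) ⦄ v<n

  neighbourAt-edge : ∀ {u p} → u < n → p < degree u → u ~ neighbourAt u p
  neighbourAt-edge {u} {p} u<n p<d with position m u
  ... | inside u<m rewrite degree-inside u<m | neighbourAt-inside {u} {p} u<m =
        u<n , subst (m + p <_) (m+[n∸m]≡n (<⇒≤ m<n)) (+-monoʳ-< m p<d) ,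
        kmAdj-intro (λ u≡m+p → <⇒≱ u<m (subst (m ≤_) (sym u≡m+p) (m≤m+n m p))) (λ _ → m≤m+n m p)
  ... | outside m≤u rewrite degree-outside m≤u | neighbourAt-outside {u} {p} m≤u with p <? u
  ...   | yes p<u rewrite skip-< p<u = u<n , <-trans p<u u<n , kmAdj-outside m≤u (<⇒≢ p<u ∘ sym)
  ...   | no  p≮u rewrite skip-≥ (≮⇒≥ p≮u) =
          u<n , subst (suc p <_) (suc-pred n ⦃ >-nonZero 0<n ⦄) (s≤s p<d) ,
          kmAdj-outside m≤u (<⇒≢ (s≤s (≮⇒≥ p≮u)))

  indexOf-neighbourAt : ∀ {u p} → indexOf u (neighbourAt u p) ≡ p
  indexOf-neighbourAt {u} {p} with position m u
  ... | inside u<m rewrite neighbourAt-inside {u} {p} u<m | indexOf-inside {u} {m + p} u<m = m+n∸m≡n m p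
  ... | outside m≤u rewrite neighbourAt-outside {u} {p} m≤u | indexOf-outside {u} {skip u p} m≤u with p <? u
  ...   | yes p<u rewrite skip-< p<u | unskip-< p<u = refl
  ...   | no  p≮u rewrite skip-≥ (≮⇒≥ p≮u) | unskip-≥ {u} {suc p} (m≤n⇒m≤1+n (≮⇒≥ p≮u)) = refl

  neighbourAt-indexOf : ∀ {u v} → u ~ v → neighbourAt u (indexOf u v) ≡ v
  neighbourAt-indexOf {u} {v} (u<n , v<n , uv) with position m u
  ... | inside u<m rewrite indexOf-inside {u} {v} u<m | neighbourAt-inside {u} {v ∸ m} u<m =
        m+[n∸m]≡n (kmAdj-inside uv u<m)
  ... | outside m≤u rewrite indexOf-outside {u} {v} m≤u | neighbourAt-outside {u} {unskip u v} m≤u with v <? u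
  ...   | yes v<u rewrite unskip-< v<u | skip-< v<u = refl
  ...   | no  v≮u with ≤∧≢⇒< (≮⇒≥ v≮u) (kmAdj-≢ uv)
  ...     | u<v rewrite unskip-≥ (<⇒≤ u<v) | skip-≥ {u} {v ∸ 1} (<⇒≤pred u<v) =
            suc-pred v ⦃ >-nonZero (≤-<-trans z≤n u<v) ⦄

  ρ : ℕ → ℕ → ℕ
  ρ u v = neighbourAt u (cycSuc (degree u) (indexOf u v))

  ρ⁻¹ : ℕ → ℕ → ℕ
  ρ⁻¹ u v = neighbourAt u (cycPred (degree u) (indexOf u v))

  iter-ρ : ∀ {u v} → u ~ v → ∀ t → iter t (ρ u) v ≡ neighbourAt u (iter t (cycSuc (degree u)) (indexOf u v))
  iter-ρ uv zero = sym (neighbourAt-indexOf uv)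
  iter-ρ {u} uv (suc t) = cong (λ p → neighbourAt u (cycSuc (degree u) p))
    (trans (cong (indexOf u) (iter-ρ uv t)) indexOf-neighbourAt)

  rotation : Rotation n (kmAdj m)
  rotation = record
    { symmetric    = kmAdj-sym
    ; irreflexive  = kmAdj-≢
    ; ρ            = ρ
    ; ρ⁻¹          = ρ⁻¹
    ; ρ-edge       = λ uv → neighbourAt-edge (proj₁ uv) (cycSuc-< (indexOf-< uv))
    ; ρ⁻¹-edge     = λ uv → neighbourAt-edge (proj₁ uv) (cycPred-< (indexOf-< uv))
    ; ρ-ρ⁻¹        = λ {u} uv → trans (cong (neighbourAt u ∘ cycSuc (degree u)) indexOf-neighbourAt)
                                   (trans (cong (neighbourAt u) (cycSuc-cycPred (indexOf-< uv)))
                                          (neighbourAt-indexOf uv))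
    ; ρ⁻¹-ρ        = λ {u} uv → trans (cong (neighbourAt u ∘ cycPred (degree u)) indexOf-neighbourAt)
                                   (trans (cong (neighbourAt u) (cycPred-cycSuc (indexOf-< uv)))
                                          (neighbourAt-indexOf uv))
    ; ρ-transitive = λ {u} uv uw → let t , eq = cycSuc-transitive (indexOf-< uv) (indexOf-< uw) in
                       t , trans (iter-ρ uv t) (trans (cong (neighbourAt u) eq) (neighbourAt-indexOf uw))
    }

  row-count : ∀ u → u < n → Σ< n (λ v → indicator (kmAdj m u v)) ≡ degree u
  row-count u u<n with position m u
  ... | inside u<m = trans (Σ<-cong n (λ v _ → cong indicator (kmAdj-inside-≡ v u<m)))
                           (trans (count-≥ n m) (sym (degree-inside u<m)))
  ... | outside m≤u = trans (Σ<-cong n (λ v _ → cong indicator (kmAdj-outside-≡ v m≤u)))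
                            (trans (count-≢ n u u<n) (sym (degree-outside m≤u)))

  degree-sum : Σ< n degree ≡ cornerCount m n
  degree-sum = begin
    Σ< n degree                                       ≡⟨ cong (λ k → Σ< k degree) (m+[n∸m]≡n (<⇒≤ m<n)) ⟨
    Σ< (m + (n ∸ m)) degree                           ≡⟨ Σ<-split m (n ∸ m) degree ⟩
    Σ< m degree + Σ< (n ∸ m) (λ k → degree (m + k))   ≡⟨ cong₂ _+_ inside-sum outside-sum ⟩
    cornerCount m n                                   ∎
    where
    open ≡-Reasoning
    inside-sum = trans (Σ<-cong m (λ _ → degree-inside)) (Σ<-const m (n ∸ m))
    outside-sum = trans (Σ<-cong (n ∸ m) (λ k _ → degree-outside (m≤m+n m k))) (Σ<-const (n ∸ m) (n ∸ 1))

  dartCount-KnMinusKm : dartCount (KnMinusKm n m) ≡ cornerCount m n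
  dartCount-KnMinusKm = begin
    dartCount (KnMinusKm n m)                                          ≡⟨ Σfin-cong n (λ u → Σfin-cong n
                                                                            (cong indicator ∘ KnMinusKm-adj u)) ⟩
    Σfin n (λ u → Σfin n (λ v → indicator (kmAdj m (toℕ u) (toℕ v)))) ≡⟨ Σfin-cong n (λ u → Σfin-toℕ n _) ⟩
    Σfin n (λ u → row (toℕ u))                                        ≡⟨ Σfin-toℕ n row ⟩
    Σ< n row                                                           ≡⟨ Σ<-cong n row-count ⟩
    Σ< n degree                                                        ≡⟨ degree-sum ⟩
    cornerCount m n                                                    ∎
    where
    open ≡-Reasoning
    row : ℕ → ℕ
    row u = Σ< n (λ v → indicator (kmAdj m u v))

  ρ-outside : ∀ {u v} → m ≤ u → ρ u v ≡ skip u (cycSuc (n ∸ 1) (unskip u v))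
  ρ-outside {u} {v} m≤u = trans (neighbourAt-outside m≤u)
    (cong₂ (λ d p → skip u (cycSuc d p)) (degree-outside m≤u) (indexOf-outside {u} {v} m≤u))

  ρ⁻¹-outside : ∀ {u v} → m ≤ u → ρ⁻¹ u v ≡ skip u (cycPred (n ∸ 1) (unskip u v))
  ρ⁻¹-outside {u} {v} m≤u = trans (neighbourAt-outside m≤u)
    (cong₂ (λ d p → skip u (cycPred d p)) (degree-outside m≤u) (indexOf-outside {u} {v} m≤u))

  ρ-inside-> : ∀ {u v} → u < m → u < ρ u v
  ρ-inside-> {u} {v} u<m = subst (u <_) (sym (neighbourAt-inside u<m)) (≤-trans u<m (m≤m+n m _))

  ρ⁻¹-inside : ∀ {u v} → u < m → m < v → ρ⁻¹ u v ≡ v ∸ 1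
  ρ⁻¹-inside {u} {v} u<m m<v with m≤n⇒∃[o]m+o≡n m<v
  ... | k , refl = begin
    ρ⁻¹ u (suc m + k)                                       ≡⟨ neighbourAt-inside u<m ⟩
    m + cycPred (degree u) (indexOf u (suc m + k))          ≡⟨ cong (λ p → m + cycPred (degree u) p) (indexOf-inside u<m) ⟩
    m + cycPred (degree u) (suc m + k ∸ m)                  ≡⟨ cong (λ p → m + cycPred (degree u) p)
                                                                     (trans (cong (_∸ m) (sym (+-suc m k))) (m+n∸m≡n m (suc k))) ⟩
    m + k                                                   ∎
    where open ≡-Reasoning

  ρ⁻¹-outside-0 : ∀ {u} → m ≤ u → 0 < u → ρ⁻¹ u 0 ≡ skip u (n ∸ 1 ∸ 1)
  ρ⁻¹-outside-0 {u} m≤u 0<u = trans (ρ⁻¹-outside m≤u) (cong (skip u ∘ cycPred (n ∸ 1)) (unskip-< 0<u))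

  ρ-above⇒successor : ∀ {u v} → u < v → m ≤ v → v < ρ v u → v ≡ suc u × ¬ (ρ u v < u)
  ρ-above⇒successor {u} {v} u<v m≤v v<ρvu with suc u <? n ∸ 1
  ... | no 1+u≮ = ⊥-elim (<⇒≱ v<ρvu (≤-trans (≤-reflexive ρvu≡0) z≤n))
    where
    ρvu≡0 : ρ v u ≡ 0
    ρvu≡0 = trans (ρ-outside m≤v) (trans (cong (skip v ∘ cycSuc (n ∸ 1)) (unskip-< u<v))
              (trans (cong (skip v) (cycSuc-last (≮⇒≥ 1+u≮))) (skip-< (≤-<-trans z≤n u<v))))
  ... | yes 1+u< = v≡1+u , ρuv≮u
    where
    ρvu≡ : ρ v u ≡ skip v (suc u)
    ρvu≡ = trans (ρ-outside m≤v) (cong (skip v) (trans (cong (cycSuc (n ∸ 1)) (unskip-< u<v)) (cycSuc-step 1+u<)))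
    v≡1+u : v ≡ suc u
    v≡1+u = ≤-antisym (≮⇒≥ (λ 1+u<v → <⇒≱ v<ρvu (≤-trans (≤-reflexive (trans ρvu≡ (skip-< 1+u<v))) (<⇒≤ 1+u<v))))
                      u<v
    ρuv≮u : ¬ (ρ u v < u)
    ρuv≮u with position m u
    ... | inside u<m = <-asym (ρ-inside-> u<m)
    ... | outside m≤u = λ ρuv<u →
            <⇒≱ ρuv<u (≤-trans (n≤1+n u) (≤-trans (n≤1+n (suc u)) (≤-reflexive (sym ρuv≡))))
      where
      ρuv≡ : ρ u v ≡ suc (suc u)
      ρuv≡ = trans (ρ-outside m≤u)
        (trans (cong (skip u ∘ cycSuc (n ∸ 1)) (trans (unskip-≥ (<⇒≤ u<v)) (cong (_∸ 1) v≡1+u)))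
        (trans (cong (skip u) (cycSuc-step 1+u<)) (skip-≥ (n≤1+n u))))

  ρ⁻¹-above⇒zero : ∀ {u v} → u < v → m ≤ v → v < ρ⁻¹ v u → u ≡ 0
  ρ⁻¹-above⇒zero {zero}      _    _   _        = refl
  ρ⁻¹-above⇒zero {suc k} {v} 1+k<v m≤v v<ρ⁻¹vu =
    ⊥-elim (<⇒≱ v<ρ⁻¹vu (≤-trans (≤-reflexive ρ⁻¹vu≡k) (<⇒≤ k<v)))
    where
    k<v = <-trans (n<1+n k) 1+k<v
    ρ⁻¹vu≡k : ρ⁻¹ v (suc k) ≡ k
    ρ⁻¹vu≡k = trans (ρ⁻¹-outside m≤v) (trans (cong (skip v ∘ cycPred (n ∸ 1)) (unskip-< 1+k<v)) (skip-< k<v))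

arcBetween : Bool × ℕ → Bool × ℕ → Arc
arcBetween (s , u) (t , v) = arc s u t v

arcBetween-injective : ∀ {p q p′ q′} → arcBetween p q ≡ arcBetween p′ q′ → p ≡ p′ × q ≡ q′
arcBetween-injective {_ , _} {_ , _} {_ , _} {_ , _} refl = refl , refl

module KmQuadrangulation (m n : ℕ) (1≤m : 1 ≤ m) (m<n : m < n) where
  open KmRotation m n 1≤m m<n
    using (rotation; degree; neighbourAt; indexOf; degree-inside; degree-outside; indexOf-<;
           neighbourAt-edge; indexOf-neighbourAt; neighbourAt-indexOf; dartCount-KnMinusKm; 0<n)
  open Interlacement rotation

  G : Graph n
  G = KnMinusKm n m

  H : Graph (n + n)
  H = interlace G

  label : Fin (n + n) → Bool × ℕ
  label i = [ (λ _ → false) , (λ _ → true) ]′ (splitAt n i) , toℕ (base {n} i)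

  vertex : Bool → (u : ℕ) → u < n → Fin (n + n)
  vertex false u u<n = fromℕ< u<n ↑ˡ n
  vertex true  u u<n = n ↑ʳ fromℕ< u<n

  label-vertex : ∀ s u (u<n : u < n) → label (vertex s u u<n) ≡ (s , u)
  label-vertex false u u<n rewrite FP.splitAt-↑ˡ n (fromℕ< u<n) n = cong (false ,_) (FP.toℕ-fromℕ< u<n)
  label-vertex true  u u<n rewrite FP.splitAt-↑ʳ n n (fromℕ< u<n) = cong (true ,_) (FP.toℕ-fromℕ< u<n)

  label-injective : ∀ {i j} → label i ≡ label j → i ≡ j
  label-injective {i} {j} eq with splitAt n i in eqᵢ | splitAt n j in eqⱼ
  ... | inj₁ a | inj₁ b = trans (sym (FP.splitAt⁻¹-↑ˡ eqᵢ))
    (trans (cong (_↑ˡ n) (FP.toℕ-injective (cong proj₂ eq))) (FP.splitAt⁻¹-↑ˡ eqⱼ))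
  ... | inj₂ a | inj₂ b = trans (sym (FP.splitAt⁻¹-↑ʳ eqᵢ))
    (trans (cong (n ↑ʳ_) (FP.toℕ-injective (cong proj₂ eq))) (FP.splitAt⁻¹-↑ʳ eqⱼ))
  ... | inj₁ a | inj₂ b with () ← cong proj₁ eq
  ... | inj₂ a | inj₁ b with () ← cong proj₁ eq

  toArc : Dart H → Arc
  toArc d = arcBetween (label (tl d)) (label (hd d))

  toArc-valid : ∀ d → ValidArc (toArc d)
  toArc-valid (dart i j ij) =
    FP.toℕ<n (base {n} i) , FP.toℕ<n (base {n} j) , subst T (KnMinusKm-adj (base {n} i) (base {n} j)) ij

  fromArc : ∀ x → ValidArc x → Dart H
  fromArc (arc s u t v) (u<n , v<n , uv) = dart (vertex s u u<n) (vertex t v v<n)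
    (subst T (sym (KnMinusKm-adj _ _)) (subst₂ (λ x y → T (kmAdj m x y))
      (sym (cong proj₂ (label-vertex s u u<n))) (sym (cong proj₂ (label-vertex t v v<n))) uv))

  toArc-fromArc : ∀ x vx → toArc (fromArc x vx) ≡ x
  toArc-fromArc (arc s u t v) (u<n , v<n , _) = cong₂ arcBetween (label-vertex s u u<n) (label-vertex t v v<n)

  toArc-injective : ∀ {d d′} → toArc d ≡ toArc d′ → d ≡ d′
  toArc-injective {dart i j ij} {dart i′ j′ ij′} eq with arcBetween-injective eq
  ... | same-tail , same-head with label-injective same-tail | label-injective same-head
  ... | refl | refl = cong (dart i j) (T-irrelevant ij ij′)

  toArc-rev : ∀ d → toArc (rev d) ≡ reverse (toArc d)
  toArc-rev (dart i j _) = refl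

  rotateH : Dart H → Dart H
  rotateH d = fromArc (rotate (toArc d)) (rotate-valid _ (toArc-valid d))

  rotateH⁻¹ : Dart H → Dart H
  rotateH⁻¹ d = fromArc (rotate⁻¹ (toArc d)) (rotate⁻¹-valid _ (toArc-valid d))

  φH : Dart H → Dart H
  φH d = rotateH (rev d)

  toArc-rotateH : ∀ d → toArc (rotateH d) ≡ rotate (toArc d)
  toArc-rotateH d = toArc-fromArc _ _

  toArc-rotateH⁻¹ : ∀ d → toArc (rotateH⁻¹ d) ≡ rotate⁻¹ (toArc d)
  toArc-rotateH⁻¹ d = toArc-fromArc _ _

  toArc-φH : ∀ d → toArc (φH d) ≡ φ (toArc d)
  toArc-φH d = trans (toArc-rotateH (rev d)) (cong rotate (toArc-rev d))

  insideCorner : Fin m → Fin (n ∸ m) → Fin (cornerCount m n)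
  insideCorner i p = F.combine i p ↑ˡ ((n ∸ m) * (n ∸ 1))

  outsideCorner : Fin (n ∸ m) → Fin (n ∸ 1) → Fin (cornerCount m n)
  outsideCorner j p = (m * (n ∸ m)) ↑ʳ F.combine j p

  -- The corner (u, v) is numbered by (u, indexOf u v) if u < m and by (u − m, indexOf u v) otherwise;
  -- the outcome of the test u <ᵇ m is an argument so that encodeWith-irrelevant can replace it.
  encodeWith : ∀ u v → .(u ~ v) → (b : Bool) → .((u <ᵇ m) ≡ b) → Fin (cornerCount m n)
  encodeWith u v uv true  e = insideCorner (fromℕ< (<ᵇ≡true⇒< {u} {m} e))
    (fromℕ< (subst (indexOf u v <_) (degree-inside (<ᵇ≡true⇒< {u} {m} e)) (indexOf-< uv)))
  encodeWith u v uv false e = outsideCorner (fromℕ< (∸-monoˡ-< (proj₁ uv) (<ᵇ≡false⇒≥ {u} {m} e)))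
    (fromℕ< (subst (indexOf u v <_) (degree-outside (<ᵇ≡false⇒≥ {u} {m} e)) (indexOf-< uv)))

  encodeWith-irrelevant : ∀ u v .(uv : u ~ v) {b b′} .(e : (u <ᵇ m) ≡ b) .(e′ : (u <ᵇ m) ≡ b′) →
                          b ≡ b′ → encodeWith u v uv b e ≡ encodeWith u v uv b′ e′
  encodeWith-irrelevant u v uv e e′ refl = refl

  encode : (c : ℕ × ℕ) → .(uncurry _~_ c) → Fin (cornerCount m n)
  encode (u , v) uv = encodeWith u v uv (u <ᵇ m) refl

  encode-cong : ∀ {c c′} .(e : uncurry _~_ c) .(e′ : uncurry _~_ c′) →
                c ≡ c′ → encode c e ≡ encode c′ e′
  encode-cong e e′ refl = refl

  cornerAt : ∀ {k} → ℕ → Fin k → ℕ × ℕ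
  cornerAt u p = u , neighbourAt u (toℕ p)

  decode : Fin (cornerCount m n) → ℕ × ℕ
  decode f with splitAt (m * (n ∸ m)) f
  ... | inj₁ x = uncurry (λ i p → cornerAt (toℕ i) p) (F.remQuot {m} (n ∸ m) x)
  ... | inj₂ y = uncurry (λ j p → cornerAt (m + toℕ j) p) (F.remQuot {n ∸ m} (n ∸ 1) y)

  m+j<n : ∀ (j : Fin (n ∸ m)) → m + toℕ j < n
  m+j<n j = subst (m + toℕ j <_) (m+[n∸m]≡n (<⇒≤ m<n)) (+-monoʳ-< m (FP.toℕ<n j))

  decode-edge : ∀ f → uncurry _~_ (decode f)
  decode-edge f with splitAt (m * (n ∸ m)) f
  ... | inj₁ x = neighbourAt-edge (<-trans i<m m<n) (subst (toℕ p <_) (sym (degree-inside i<m)) (FP.toℕ<n p))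
    where
    p = proj₂ (F.remQuot {m} (n ∸ m) x)
    i<m = FP.toℕ<n (proj₁ (F.remQuot {m} (n ∸ m) x))
  ... | inj₂ y = neighbourAt-edge (m+j<n j)
                   (subst (toℕ p <_) (sym (degree-outside (m≤m+n m (toℕ j)))) (FP.toℕ<n p))
    where
    j = proj₁ (F.remQuot {n ∸ m} (n ∸ 1) y)
    p = proj₂ (F.remQuot {n ∸ m} (n ∸ 1) y)

  decode-inside : ∀ i p → decode (insideCorner i p) ≡ cornerAt (toℕ i) p
  decode-inside i p rewrite FP.splitAt-↑ˡ (m * (n ∸ m)) (F.combine i p) ((n ∸ m) * (n ∸ 1)) =
    cong (uncurry (λ i p → cornerAt (toℕ i) p)) (FP.remQuot-combine i p)

  decode-outside : ∀ j p → decode (outsideCorner j p) ≡ cornerAt (m + toℕ j) p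
  decode-outside j p rewrite FP.splitAt-↑ʳ (m * (n ∸ m)) ((n ∸ m) * (n ∸ 1)) (F.combine j p) =
    cong (uncurry (λ j p → cornerAt (m + toℕ j) p)) (FP.remQuot-combine j p)

  cornerAt-≡ : ∀ {k u u′ v} {p : Fin k} → u ≡ u′ → neighbourAt u′ (toℕ p) ≡ v → cornerAt u p ≡ (u′ , v)
  cornerAt-≡ refl = cong (_ ,_)

  decode-encodeWith : ∀ u v (uv : u ~ v) b (e : (u <ᵇ m) ≡ b) → decode (encodeWith u v uv b e) ≡ (u , v)
  decode-encodeWith u v uv true e = trans (decode-inside _ _)
    (cornerAt-≡ (FP.toℕ-fromℕ< _) (trans (cong (neighbourAt u) (FP.toℕ-fromℕ< _)) (neighbourAt-indexOf uv)))
  decode-encodeWith u v uv false e = trans (decode-outside _ _)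
    (cornerAt-≡ (trans (cong (m +_) (FP.toℕ-fromℕ< _)) (m+[n∸m]≡n (<ᵇ≡false⇒≥ {u} {m} e)))
                (trans (cong (neighbourAt u) (FP.toℕ-fromℕ< _)) (neighbourAt-indexOf uv)))

  decode-encode : ∀ c (e : uncurry _~_ c) → decode (encode c e) ≡ c
  decode-encode (u , v) uv = decode-encodeWith u v uv (u <ᵇ m) refl

  encode-decode : ∀ f → encode (decode f) (decode-edge f) ≡ f
  encode-decode f with splitAt (m * (n ∸ m)) f in eq
  ... | inj₁ x =
    trans (encodeWith-irrelevant u _ _ refl u<ᵇm u<ᵇm)
   (trans (cong₂ insideCorner (FP.fromℕ<-toℕ i _) (fromℕ<-≡ p _ (sym indexOf-neighbourAt)))
   (trans (cong (_↑ˡ ((n ∸ m) * (n ∸ 1))) (FP.combine-remQuot {m} (n ∸ m) x))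
          (FP.splitAt⁻¹-↑ˡ eq)))
    where
    i = proj₁ (F.remQuot {m} (n ∸ m) x)
    p = proj₂ (F.remQuot {m} (n ∸ m) x)
    u = toℕ i
    u<ᵇm = <⇒<ᵇ≡true (FP.toℕ<n i)
  ... | inj₂ y =
    trans (encodeWith-irrelevant u _ _ refl u<ᵇm u<ᵇm)
   (trans (cong₂ outsideCorner (fromℕ<-≡ j _ (sym (m+n∸m≡n m (toℕ j)))) (fromℕ<-≡ p _ (sym indexOf-neighbourAt)))
   (trans (cong ((m * (n ∸ m)) ↑ʳ_) (FP.combine-remQuot {n ∸ m} (n ∸ 1) y))
          (FP.splitAt⁻¹-↑ʳ eq)))
    where
    j = proj₁ (F.remQuot {n ∸ m} (n ∸ 1) y)
    p = proj₂ (F.remQuot {n ∸ m} (n ∸ 1) y)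
    u = m + toℕ j
    u<ᵇm = ≥⇒<ᵇ≡false (m≤m+n m (toℕ j))

  faceOf : Dart H → Fin (cornerCount m n)
  faceOf d = encode (corner (toArc d)) (corner-edge (toArc d) (toArc-valid d))

  decode-faceOf : ∀ d → decode (faceOf d) ≡ corner (toArc d)
  decode-faceOf d = decode-encode (corner (toArc d)) (corner-edge (toArc d) (toArc-valid d))

  same-face⇒same-corner : ∀ {d d′} → faceOf d ≡ faceOf d′ → corner (toArc d) ≡ corner (toArc d′)
  same-face⇒same-corner {d} {d′} eq = trans (sym (decode-faceOf d)) (trans (cong decode eq) (decode-faceOf d′))

  last : Fin n
  last = fromℕ< (m≤pred[n]⇒suc[m]≤n ⦃ >-nonZero 0<n ⦄ ≤-refl)

  m≤last : m ≤ toℕ last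
  m≤last = subst (m ≤_) (sym (FP.toℕ-fromℕ< _)) (<⇒≤pred m<n)

  last-dominating : ∀ v → v ≢ last → T (adj G v last)
  last-dominating v v≢last =
    subst T (sym (KnMinusKm-adj v last)) (kmAdj-intro (v≢last ∘ FP.toℕ-injective) (λ _ → m≤last))

  first≢last : fromℕ< 0<n ≢ last
  first≢last eq = <⇒≢ (≤-trans 1≤m m≤last) (trans (sym (FP.toℕ-fromℕ< 0<n)) (cong toℕ eq))

  numEdges-H : numEdges H ≡ 2 * cornerCount m n
  numEdges-H = trans (numEdges-interlace G) (cong (2 *_) dartCount-KnMinusKm)

  quadrangulation : Quadrangulation H (genusFormula n m)
  quadrangulation = record
    { σ           = rotateH
    ; σ⁻¹         = rotateH⁻¹
    ; σ-inv₁      = λ d → toArc-injective (trans (toArc-rotateH⁻¹ (rotateH d))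
                            (trans (cong rotate⁻¹ (toArc-rotateH d)) (rotate⁻¹-rotate _ (toArc-valid d))))
    ; σ-inv₂      = λ d → toArc-injective (trans (toArc-rotateH (rotateH⁻¹ d))
                            (trans (cong rotate (toArc-rotateH⁻¹ d)) (rotate-rotate⁻¹ _ (toArc-valid d))))
    ; σ-tail      = λ d → label-injective (trans (cong origin (toArc-rotateH d)) (origin-rotate (toArc d)))
    ; σ-cyclic    = λ d d′ same-tail →
        let k , eq = rotate-transitive (toArc d) (toArc d′) (toArc-valid d) (toArc-valid d′) (cong label same-tail)
        in k , toArc-injective (trans (iter-commute toArc rotateH rotate toArc-rotateH k d) eq)
    ; faces       = cornerCount m n
    ; face        = faceOf
    ; face-surj   = λ f → fromArc (cornerArc (decode f)) (decode-edge f) ,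
        trans (encode-cong _ _ (cong corner (toArc-fromArc (cornerArc (decode f)) (decode-edge f))))
              (encode-decode f)
    ; face-orb₁   = λ d d′ same-face →
        let k , eq = same-corner⇒same-face (toArc d) (toArc d′) (toArc-valid d) (toArc-valid d′)
                                           (same-face⇒same-corner {d} {d′} same-face)
        in k , toArc-injective (trans (iter-commute toArc φH φ toArc-φH k d) eq)
    ; face-orb₂   = λ d → encode-cong _ _ (trans (cong corner (toArc-φH d)) (corner-φ (toArc d) (toArc-valid d)))
    ; quad-len    = λ d → toArc-injective
        (trans (iter-commute toArc φH φ toArc-φH 4 d) (φ⁴ (toArc d) (toArc-valid d)))
    ; quad-simple = λ d i j i<4 j<4 i≢j same-tail →
        pairwise-distinct₄ (φ-origins-distinct (toArc d) (toArc-valid d)) i j i<4 j<4 i≢j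
          (trans (cong origin (sym (iter-commute toArc φH φ toArc-φH i d)))
          (trans (cong label same-tail) (cong origin (iter-commute toArc φH φ toArc-φH j d))))
    ; two-faces   = λ d same-face → ~-irrefl (corner-reverse-~ (toArc d) (toArc-valid d))
        (cong proj₁ (trans (same-face⇒same-corner {d} {rev d} same-face) (cong corner (toArc-rev d))))
    ; connected   = interlace-connected G last (fromℕ< 0<n) first≢last last-dominating
    ; euler       = trans (euler-count 1≤m m<n) (cong (2 +_) (sym numEdges-H))
    }

  corner-colouring : ∀ {k} (κ : ℕ × ℕ → Fin k) → (∀ z → ValidArc z → κ (corner z) ≢ κ (corner (reverse z))) →
                     FaceColoring quadrangulation k
  corner-colouring κ proper = κ ∘ decode , λ d same → proper (toArc d) (toArc-valid d) (begin
    κ (corner (toArc d))           ≡⟨ cong κ (decode-faceOf d) ⟨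
    κ (decode (faceOf d))          ≡⟨ same ⟩
    κ (decode (faceOf (rev d)))    ≡⟨ cong κ (decode-faceOf (rev d)) ⟩
    κ (corner (toArc (rev d)))     ≡⟨ cong (κ ∘ corner) (toArc-rev d) ⟩
    κ (corner (reverse (toArc d))) ∎)
    where open ≡-Reasoning

  corners-adjacent : ∀ z (vz : ValidArc z) {c c′} .(e : uncurry _~_ c) .(e′ : uncurry _~_ c′) →
                     corner z ≡ c → corner (reverse z) ≡ c′ →
                     FacesAdjacent quadrangulation (encode c e) (encode c′ e′)
  corners-adjacent z vz e e′ refl refl = fromArc z vz ,
    encode-cong _ _ (cong corner (toArc-fromArc z vz)) ,
    encode-cong _ _ (cong corner (trans (toArc-rev (fromArc z vz)) (cong reverse (toArc-fromArc z vz))))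

parity : ℕ → Fin 3
parity zero          = 0F
parity (suc zero)    = 1F
parity (suc (suc u)) = parity u

parity-suc-≢ : ∀ u → parity u ≢ parity (suc u)
parity-suc-≢ zero          ()
parity-suc-≢ (suc zero)    ()
parity-suc-≢ (suc (suc u)) = parity-suc-≢ u

parity-≢-2F : ∀ u → parity u ≢ 2F
parity-≢-2F zero          ()
parity-≢-2F (suc zero)    ()
parity-≢-2F (suc (suc u)) = parity-≢-2F u

module KmFaceColouring (m n : ℕ) (1≤m : 1 ≤ m) (m<n : m < n) where
  open KmRotation m n 1≤m m<n
  open Interlacement rotation using (ValidArc; corner; ~-sym; ~-irrefl; ρ-≢; ρ⁻¹-≢; ρ-ρ⁻¹; corner-reverse-~)
  open KmQuadrangulation m n 1≤m m<n using (quadrangulation; corner-colouring; corners-adjacent)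

  -- A corner (u, a) whose successor ρ u a lies above u is coloured by the parity of u, the others by
  -- 1 or 2 as a > u or a < u. Across an edge xy with x < y a clash forces y = x + 1 or x = 0.
  colour : ℕ → ℕ → Fin 3
  colour u a = if ρ u a <ᵇ u then (if a <ᵇ u then 2F else 1F) else parity u

  colour-≥ : ∀ {u a} → ¬ (ρ u a < u) → colour u a ≡ parity u
  colour-≥ {u} {a} ρ≮u = cong (if_then (if a <ᵇ u then 2F else 1F) else parity u) (≥⇒<ᵇ≡false (≮⇒≥ ρ≮u))

  colour-< : ∀ {u a} → ρ u a < u → colour u a ≡ (if a <ᵇ u then 2F else 1F)
  colour-< {u} {a} ρ<u = cong (if_then (if a <ᵇ u then 2F else 1F) else parity u) (<⇒<ᵇ≡true ρ<u)

  -- The corners at x that contain the edge xy.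
  Side : ℕ → ℕ → ℕ → Set
  Side x y a = a ≡ y ⊎ a ≡ ρ⁻¹ x y

  colour-lower : ∀ {x y a} → x < y → x ~ y → Side x y a →
                 colour x a ≡ parity x ⊎ (colour x a ≡ 1F × ρ x y < x)
  colour-lower {x} {y} x<y xy (inj₂ refl) =
    inj₁ (colour-≥ (λ ρ<x → <⇒≱ x<y (≤-trans (≤-reflexive (sym (ρ-ρ⁻¹ xy))) (<⇒≤ ρ<x))))
  colour-lower {x} {y} x<y xy (inj₁ refl) with ρ x y <? x
  ... | yes ρ<x = inj₂ (trans (colour-< ρ<x) (cong (if_then 2F else 1F) (≥⇒<ᵇ≡false (<⇒≤ x<y))) , ρ<x)
  ... | no  ρ≮x = inj₁ (colour-≥ ρ≮x)

  colour-upper : ∀ {x y b} → x < y → x ~ y → Side y x b →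
                 colour y b ≡ 2F ⊎ (colour y b ≡ parity y × y < ρ y x) ⊎ (colour y b ≡ 1F × y < ρ⁻¹ y x)
  colour-upper {x} {y} x<y xy (inj₁ refl) with ρ y x <? y
  ... | yes ρ<y = inj₁ (trans (colour-< ρ<y) (cong (if_then 2F else 1F) (<⇒<ᵇ≡true x<y)))
  ... | no  ρ≮y = inj₂ (inj₁ (colour-≥ ρ≮y , ≤∧≢⇒< (≮⇒≥ ρ≮y) (ρ-≢ (~-sym xy) ∘ sym)))
  colour-upper {x} {y} x<y xy (inj₂ refl) with ρ⁻¹ y x <? y
  ... | yes ρ⁻¹<y = inj₁ (trans (colour-< ρρ⁻¹<y) (cong (if_then 2F else 1F) (<⇒<ᵇ≡true ρ⁻¹<y)))
    where ρρ⁻¹<y = subst (_< y) (sym (ρ-ρ⁻¹ (~-sym xy))) x<y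
  ... | no  ρ⁻¹≮y = inj₂ (inj₂
          (trans (colour-< ρρ⁻¹<y) (cong (if_then 2F else 1F) (≥⇒<ᵇ≡false (≮⇒≥ ρ⁻¹≮y))) ,
           ≤∧≢⇒< (≮⇒≥ ρ⁻¹≮y) (ρ⁻¹-≢ (~-sym xy) ∘ sym)))
    where ρρ⁻¹<y = subst (_< y) (sym (ρ-ρ⁻¹ (~-sym xy))) x<y

  m≤upper : ∀ {x y} → x < y → x ~ y → m ≤ y
  m≤upper {x} x<y (_ , _ , xy) with position m x
  ... | inside x<m  = kmAdj-inside xy x<m
  ... | outside m≤x = ≤-trans m≤x (<⇒≤ x<y)

  colour-across-< : ∀ {x y a b} → x < y → x ~ y → Side x y a → Side y x b → colour x a ≢ colour y b
  colour-across-< {x} {y} x<y xy ha hb = clash (colour-lower x<y xy ha) (colour-upper x<y xy hb)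
    where
    m≤y = m≤upper x<y xy
    clash : ∀ {a b} → (colour x a ≡ parity x ⊎ (colour x a ≡ 1F × ρ x y < x)) →
            (colour y b ≡ 2F ⊎ (colour y b ≡ parity y × y < ρ y x) ⊎ (colour y b ≡ 1F × y < ρ⁻¹ y x)) →
            colour x a ≢ colour y b
    clash (inj₁ p) (inj₁ q) same = parity-≢-2F x (trans (sym p) (trans same q))
    clash (inj₁ p) (inj₂ (inj₁ (q , y<ρ))) same with ρ-above⇒successor x<y m≤y y<ρ
    ... | refl , _ = parity-suc-≢ x (trans (sym p) (trans same q))
    clash (inj₁ p) (inj₂ (inj₂ (q , y<ρ⁻¹))) same with ρ⁻¹-above⇒zero x<y m≤y y<ρ⁻¹
    ... | refl with () ← trans (sym p) (trans same q)
    clash (inj₂ (p , _)) (inj₁ q) same with () ← trans (sym p) (trans same q)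
    clash (inj₂ (_ , ρ<x)) (inj₂ (inj₁ (_ , y<ρ))) _ = proj₂ (ρ-above⇒successor x<y m≤y y<ρ) ρ<x
    clash (inj₂ (_ , ρ<x)) (inj₂ (inj₂ (_ , y<ρ⁻¹))) _ with ρ⁻¹-above⇒zero x<y m≤y y<ρ⁻¹
    ... | refl with () ← ρ<x

  colour-across : ∀ {x y a b} → x ~ y → Side x y a → Side y x b → colour x a ≢ colour y b
  colour-across {x} {y} xy ha hb with <-cmp x y
  ... | tri< x<y _ _ = colour-across-< x<y xy ha hb
  ... | tri≈ _ x≡y _ = ⊥-elim (~-irrefl xy x≡y)
  ... | tri> _ _ y<x = colour-across-< y<x (~-sym xy) hb ha ∘ sym

  colour-proper : ∀ z → ValidArc z → uncurry colour (corner z) ≢ uncurry colour (corner (reverse z))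
  colour-proper (arc false _ false _) uv = colour-across uv (inj₁ refl) (inj₁ refl)
  colour-proper (arc false _ true  _) vu = colour-across (~-sym vu) (inj₁ refl) (inj₂ refl)
  colour-proper (arc true  _ true  _) uw = colour-across uw (inj₂ refl) (inj₂ refl)
  colour-proper (arc true  _ false _) wu = colour-across (~-sym wu) (inj₂ refl) (inj₁ refl)

  three-colouring : FaceColoring quadrangulation 3
  three-colouring = corner-colouring (uncurry colour) colour-proper

  side : ℕ → Fin 2
  side u = if u <ᵇ m then 0F else 1F

  side-inside : ∀ {u} → u < m → side u ≡ 0F
  side-inside u<m = cong (if_then 0F else 1F) (<⇒<ᵇ≡true u<m)

  side-outside : ∀ {u} → m ≤ u → side u ≡ 1F
  side-outside m≤u = cong (if_then 0F else 1F) (≥⇒<ᵇ≡false m≤u)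

  -- For n = m + 1 the graph is a star with centre m, so faces are two-coloured by the side of their
  -- corner vertex.
  side-proper : n ≡ suc m → ∀ {x y} → x ~ y → side x ≢ side y
  side-proper n≡1+m {x} {y} (x<n , y<n , xy) same with position m x | position m y
  ... | inside x<m  | _ with () ← trans (sym (side-inside x<m)) (trans same (side-outside (kmAdj-inside xy x<m)))
  ... | outside m≤x | inside y<m with () ← trans (sym (side-outside m≤x)) (trans same (side-inside y<m))
  ... | outside m≤x | outside m≤y = kmAdj-≢ xy (trans (centre m≤x x<n) (sym (centre m≤y y<n)))
    where
    centre : ∀ {u} → m ≤ u → u < n → u ≡ m
    centre m≤u u<n = ≤-antisym (s≤s⁻¹ (subst (_ <_) n≡1+m u<n)) m≤u

  two-colouring : n ≡ suc m → FaceColoring quadrangulation 2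
  two-colouring n≡1+m = corner-colouring (side ∘ proj₁) (λ z vz → side-proper n≡1+m (corner-reverse-~ z vz))

  z : ℕ
  z = n ∸ 1

  z<n : z < n
  z<n = m≤pred[n]⇒suc[m]≤n ⦃ >-nonZero (≤-<-trans z≤n m<n) ⦄ ≤-refl

  m≤z : m ≤ z
  m≤z = <⇒≤pred m<n

  0~z : 0 ~ z
  0~z = ≤-<-trans z≤n m<n , z<n , kmAdj-intro (<⇒≢ (≤-trans 1≤m m≤z)) (λ _ → m≤z)

  two-colours-needed : ∀ {j} → FaceColoring quadrangulation j → 2 ≤ j
  two-colours-needed =
    faceColouring-2≤ {Q = quadrangulation} (corners-adjacent (arc false 0 false z) 0~z 0~z (~-sym 0~z) refl refl)

  -- When n ≥ m + 2 the faces at the corners (z, y), (y, z) and (0, y), where y + 1 = z = n − 1,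
  -- pairwise share an edge.
  module _ (1+m<n : suc m < n) where
    y : ℕ
    y = z ∸ 1

    m≤y : m ≤ y
    m≤y = ∸-monoˡ-≤ 1 (<⇒≤pred 1+m<n)

    1+y≡z : suc y ≡ z
    1+y≡z = suc-pred z ⦃ >-nonZero (≤-trans 1≤m m≤z) ⦄

    y<z : y < z
    y<z = ≤-reflexive 1+y≡z

    z~y : z ~ y
    z~y = z<n , <-trans y<z z<n , kmAdj-outside m≤z (<⇒≢ y<z ∘ sym)

    0~y : 0 ~ y
    0~y = ≤-<-trans z≤n m<n , <-trans y<z z<n , kmAdj-intro (<⇒≢ (≤-trans 1≤m m≤y)) (λ _ → m≤y)

    three-colours-needed : ∀ {j} → FaceColoring quadrangulation j → 3 ≤ j
    three-colours-needed = faceColouring-3≤ {Q = quadrangulation}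
      (corners-adjacent (arc false z false y) z~y z~y (~-sym z~y) refl refl)
      (corners-adjacent (arc true z true 0) (~-sym 0~z) z~y 0~y (cong (z ,_) ρ⁻¹z0≡y) (cong (0 ,_) ρ⁻¹0z≡y))
      (corners-adjacent (arc true 0 false y) 0~y (~-sym z~y) 0~y (cong (y ,_) ρ⁻¹y0≡z) refl)
      where
      ρ⁻¹z0≡y : ρ⁻¹ z 0 ≡ y
      ρ⁻¹z0≡y = trans (ρ⁻¹-outside-0 m≤z (≤-trans 1≤m m≤z)) (skip-< y<z)
      ρ⁻¹y0≡z : ρ⁻¹ y 0 ≡ z
      ρ⁻¹y0≡z = trans (ρ⁻¹-outside-0 m≤y (≤-trans 1≤m m≤y)) (trans (skip-≥ {y} {z ∸ 1} ≤-refl) 1+y≡z)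
      ρ⁻¹0z≡y : ρ⁻¹ 0 z ≡ y
      ρ⁻¹0z≡y = ρ⁻¹-inside 1≤m (≤-<-trans m≤y y<z)

  face-chromatic : ∃ λ j → IsFaceChromaticNumber quadrangulation j × j ≤ n ∸ m + 1
  face-chromatic with m≤n⇒m<n∨m≡n m<n
  ... | inj₂ 1+m≡n = 2 , (two-colouring (sym 1+m≡n) , λ j j<2 c → <⇒≱ j<2 (two-colours-needed c)) ,
                     subst (2 ≤_) (+-comm 1 (n ∸ m)) (s≤s (m<n⇒0<n∸m m<n))
  ... | inj₁ 1+m<n = 3 , (three-colouring , λ j j<3 c → <⇒≱ j<3 (three-colours-needed 1+m<n c)) ,
                     subst (3 ≤_) (+-comm 1 (n ∸ m)) (s≤s (m+n≤o⇒m≤o∸n 2 1+m<n))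

module KmChromatic (m n : ℕ) (1≤m : 1 ≤ m) (m<n : m < n) where

  shade : ℕ → ℕ
  shade u = if u <ᵇ m then 0 else suc (u ∸ m)

  shade-inside : ∀ {u} → u < m → shade u ≡ 0
  shade-inside {u} u<m = cong (if_then 0 else suc (u ∸ m)) (<⇒<ᵇ≡true u<m)

  shade-outside : ∀ {u} → m ≤ u → shade u ≡ suc (u ∸ m)
  shade-outside {u} m≤u = cong (if_then 0 else suc (u ∸ m)) (≥⇒<ᵇ≡false m≤u)

  shade-< : ∀ {u} → u < n → shade u < suc (n ∸ m)
  shade-< {u} u<n with position m u
  ... | inside u<m  rewrite shade-inside u<m  = s≤s z≤n
  ... | outside m≤u rewrite shade-outside m≤u = s≤s (∸-monoˡ-< u<n m≤u)

  shade-proper : ∀ {u v} → T (kmAdj m u v) → shade u ≢ shade v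
  shade-proper {u} {v} uv same with position m u | position m v
  ... | inside u<m  | inside v<m  = <⇒≱ v<m (kmAdj-inside uv u<m)
  ... | inside u<m  | outside m≤v with () ← trans (sym (shade-inside u<m)) (trans same (shade-outside m≤v))
  ... | outside m≤u | inside v<m  with () ← trans (sym (shade-outside m≤u)) (trans same (shade-inside v<m))
  ... | outside m≤u | outside m≤v = kmAdj-≢ uv (begin
    u            ≡⟨ m+[n∸m]≡n m≤u ⟨
    m + (u ∸ m)  ≡⟨ cong (m +_) (suc-injective (trans (sym (shade-outside m≤u))
                                                       (trans same (shade-outside m≤v)))) ⟩
    m + (v ∸ m)  ≡⟨ m+[n∸m]≡n m≤v ⟩
    v            ∎)
    where open ≡-Reasoning

  colouring : ProperColoring (KnMinusKm n m) (suc (n ∸ m))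
  colouring = (λ v → fromℕ< (shade-< (FP.toℕ<n v))) , λ u v uv same →
    shade-proper (subst T (KnMinusKm-adj u v) uv) (trans (sym (FP.toℕ-fromℕ< (shade-< (FP.toℕ<n u))))
                                                  (trans (cong toℕ same) (FP.toℕ-fromℕ< (shade-< (FP.toℕ<n v)))))

  cliqueℕ : Fin (suc (n ∸ m)) → ℕ
  cliqueℕ fz     = 0
  cliqueℕ (fs k) = m + toℕ k

  cliqueℕ-< : ∀ k → cliqueℕ k < n
  cliqueℕ-< fz     = ≤-<-trans z≤n m<n
  cliqueℕ-< (fs k) = subst (m + toℕ k <_) (m+[n∸m]≡n (<⇒≤ m<n)) (+-monoʳ-< m (FP.toℕ<n k))

  cliqueℕ-adjacent : ∀ {x y} → x ≢ y → T (kmAdj m (cliqueℕ x) (cliqueℕ y))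
  cliqueℕ-adjacent {fz}   {fz}   x≢y = ⊥-elim (x≢y refl)
  cliqueℕ-adjacent {fz}   {fs l} _   = kmAdj-intro (<⇒≢ (≤-trans 1≤m (m≤m+n m (toℕ l)))) (λ _ → m≤m+n m (toℕ l))
  cliqueℕ-adjacent {fs k} {fz}   _   = kmAdj-outside (m≤m+n m (toℕ k)) (<⇒≢ (≤-trans 1≤m (m≤m+n m (toℕ k))) ∘ sym)
  cliqueℕ-adjacent {fs k} {fs l} x≢y = kmAdj-outside (m≤m+n m (toℕ k))
                                                     (x≢y ∘ cong fs ∘ FP.toℕ-injective ∘ +-cancelˡ-≡ m _ _)

  clique : Fin (suc (n ∸ m)) → Fin n
  clique k = fromℕ< (cliqueℕ-< k)

  clique-adjacent : ∀ {x y} → x ≢ y → T (adj (KnMinusKm n m) (clique x) (clique y))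
  clique-adjacent {x} {y} x≢y = subst T (sym (KnMinusKm-adj (clique x) (clique y)))
    (subst₂ (λ u v → T (kmAdj m u v)) (sym (FP.toℕ-fromℕ< (cliqueℕ-< x))) (sym (FP.toℕ-fromℕ< (cliqueℕ-< y)))
            (cliqueℕ-adjacent x≢y))

  chromatic : IsChromaticNumber (KnMinusKm n m) (n ∸ m + 1)
  chromatic = subst (IsChromaticNumber (KnMinusKm n m)) (+-comm 1 (n ∸ m))
    (colouring , λ j j<k c → <⇒≱ j<k (clique⇒colours-≥ (KnMinusKm n m) clique clique-adjacent c))

corollary3p8 : ∀ (n m : ℕ) → 1 ≤ m → 2 ≤ n → m ≤ n ∸ 1 →
    IsChromaticNumber (interlace (KnMinusKm n m)) (n ∸ m + 1)
    × Σ (Quadrangulation (interlace (KnMinusKm n m)) (genusFormula n m))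
        (λ Q → ∃ λ j → IsFaceChromaticNumber Q j × j ≤ n ∸ m + 1)
    × (1 ≤ genusFormula n m → 4 + 2 * (m * (m ∸ 1)) ≤ n →
        ∀ (Q : Quadrangulation (interlace (KnMinusKm n m)) (genusFormula n m)) → IsMinimal Q)
corollary3p8 n m 1≤m 2≤n m≤n∸1 =
    interlace-chromatic {G = KnMinusKm n m} (KmChromatic.chromatic m n 1≤m m<n)
  , (KmQuadrangulation.quadrangulation m n 1≤m m<n , KmFaceColouring.face-chromatic m n 1≤m m<n)
  , λ _ n-large _ N′ H′ Q′ → genus-forces-vertices 1≤m n-large (quadrangulation-bound Q′)
  where
  m<n : m < n
  m<n = m≤pred[n]⇒suc[m]≤n ⦃ >-nonZero (≤-trans (s≤s z≤n) 2≤n) ⦄ m≤n∸1
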